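{- For all nonnegative integers $l,m,n,u$, \[ \sum_{k=0}^{n}\frac{q^{k^2+uk}(q)_{l+m+n-k}}{(q)_k(q)_{l-k}(q)_{m-k}(q)_{n-k}(q)_{u+k}} =\sum_{k=-n}^{n}\frac{(-1)^kq^{(3k^2-k)/2}(q)_{l+m}(q)_{m+n}(q)_{l+n}(q)_u}{(q)_{l-k}(q)_{m-k}(q)_{n-k}(q)_{u-k}(q)_{l+k}(q)_{m+k}(q)_{n+k}(q)_{u+k}}, \] and \[ \sum_{k=0}^{n}\frac{q^{k^2+(u+1)k}(q)_{l+m+n-k+1}}{(q)_k(q)_{l-k}(q)_{m-k}(q)_{n-k}(q)_{u+k+1}} =\sum_{k=-n-1}^{n}\frac{(-1)^kq^{(3k^2+k)/2}(q)_{l+m+1}(q)_{m+n+1}(q)_{l+n+1}(q)_u}{(q)_{l-k}(q)_{m-k}(q)_{n-k}(q)_{u-k}(q)_{l+k+1}(q)_{m+k+1}(q)_{n+k+1}(q)_{u+k+1}}. \]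
   Context: Throughout, $q$ is a complex number with $0<|q|<1$. For an integer $N\ge0$, $(q)_N=(1-q)(1-q^2)\cdots(1-q^N)$ (with $(q)_0=1$), and by convention $1/(q)_N=0$ for $N<0$. -}

module Defs where

open import Level using (Level)
open import Algebra.Bundles using (CommutativeRing)
open import Data.Nat as ℕ using (ℕ; zero; suc)
open import Data.Integer as ℤ using (ℤ; +_; -[1+_]; ∣_∣)
import Data.Nat.DivMod as ND

-- Everything is expressed in an arbitrary commutative ring R, with a chosen
-- element q and a family inv N meant to be the inverse of (q)_N
-- (the hypothesis that it really is an inverse is part of the statement).
module QSeries {c ℓ : Level} (R : CommutativeRing c ℓ)
               (q : CommutativeRing.Carrier R)
               (inv : ℕ → CommutativeRing.Carrier R) where
  open CommutativeRing R

  pow : Carrier → ℕ → Carrier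
  pow x zero    = 1#
  pow x (suc n) = x * pow x n

  poch : ℕ → Carrier
  poch zero    = 1#
  poch (suc N) = poch N * (1# + - pow q (suc N))

  -- 1/(q)_N for integer N, with 1/(q)_N = 0 for N < 0
  pinv : ℤ → Carrier
  pinv (+ N)    = inv N
  pinv -[1+ N ] = 0#

  sgn : ℤ → Carrier
  sgn k = pow (- 1#) ∣ k ∣

  pentM : ℤ → ℕ
  pentM k = ∣ (+ 3) ℤ.* k ℤ.* k ℤ.- k ∣ ND./ 2

  pentP : ℤ → ℕ
  pentP k = ∣ (+ 3) ℤ.* k ℤ.* k ℤ.+ k ∣ ND./ 2

  sumℕ : ℕ → (ℕ → Carrier) → Carrier
  sumℕ zero    f = f 0
  sumℕ (suc n) f = sumℕ n f + f (suc n)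

  sumFrom : ℤ → ℕ → (ℤ → Carrier) → Carrier
  sumFrom s zero    f = 0#
  sumFrom s (suc c) f = f s + sumFrom (s ℤ.+ + 1) c f

  sumℤ : ℤ → ℤ → (ℤ → Carrier) → Carrier
  sumℤ a b f = sumFrom a ∣ b ℤ.- a ℤ.+ + 1 ∣ f

  lhs1 : ℕ → ℕ → ℕ → ℕ → Carrier
  lhs1 l m n u = sumℕ n λ k →
    pow q (k ℕ.* k ℕ.+ u ℕ.* k) * poch (l ℕ.+ m ℕ.+ n ℕ.∸ k)
    * inv k * pinv (+ l ℤ.- + k) * pinv (+ m ℤ.- + k) * pinv (+ n ℤ.- + k)
    * inv (u ℕ.+ k)

  rhs1 : ℕ → ℕ → ℕ → ℕ → Carrier
  rhs1 l m n u = sumℤ (ℤ.- (+ n)) (+ n) λ k →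
    sgn k * pow q (pentM k)
    * poch (l ℕ.+ m) * poch (m ℕ.+ n) * poch (l ℕ.+ n) * poch u
    * pinv (+ l ℤ.- k) * pinv (+ m ℤ.- k) * pinv (+ n ℤ.- k) * pinv (+ u ℤ.- k)
    * pinv (+ l ℤ.+ k) * pinv (+ m ℤ.+ k) * pinv (+ n ℤ.+ k) * pinv (+ u ℤ.+ k)

  lhs2 : ℕ → ℕ → ℕ → ℕ → Carrier
  lhs2 l m n u = sumℕ n λ k →
    pow q (k ℕ.* k ℕ.+ (u ℕ.+ 1) ℕ.* k) * poch (l ℕ.+ m ℕ.+ n ℕ.∸ k ℕ.+ 1)
    * inv k * pinv (+ l ℤ.- + k) * pinv (+ m ℤ.- + k) * pinv (+ n ℤ.- + k)
    * inv (u ℕ.+ k ℕ.+ 1)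

  rhs2 : ℕ → ℕ → ℕ → ℕ → Carrier
  rhs2 l m n u = sumℤ (ℤ.- (+ n) ℤ.- + 1) (+ n) λ k →
    sgn k * pow q (pentP k)
    * poch (l ℕ.+ m ℕ.+ 1) * poch (m ℕ.+ n ℕ.+ 1) * poch (l ℕ.+ n ℕ.+ 1) * poch u
    * pinv (+ l ℤ.- k) * pinv (+ m ℤ.- k) * pinv (+ n ℤ.- k) * pinv (+ u ℤ.- k)
    * pinv (+ l ℤ.+ k ℤ.+ + 1) * pinv (+ m ℤ.+ k ℤ.+ + 1) * pinv (+ n ℤ.+ k ℤ.+ + 1)
    * pinv (+ u ℤ.+ k ℤ.+ + 1)

-- Both identities are the cases e = 0 and e = 1 of one identity. Put σ_j = (-1)^j q^{j(j-1)/2} and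
-- A_j(x) = 1/((q)_{x-j} (q)_{x+j+e}). The q-binomial theorem gives the unit Bailey pair
-- Σ_j σ_j A_j(N) = δ_{N,0}; expanding A_j(k) A_j(u) (q)_{k+u+e} in the A_j(N) by q-Chu–Vandermonde
-- turns it into Σ_j σ_j A_j(k) A_j(u) = q^{ku} / ((q)_k (q)_u (q)_{k+u+e}). Substituting this into the
-- left-hand side, exchanging the sums and evaluating the inner sum over k by the q-Pfaff–Saalschütz
-- summation (proved with a WZ certificate) gives the right-hand side; the exponent j(j-1)/2 + J(J + e),
-- J = max(j, -j-e), that appears there is the pentagonal number of the statement.

module Submission where

open import Defs
open import Level using (Level)
open import Algebra.Bundles using (CommutativeRing)
open import Data.Nat as ℕ using (ℕ; zero; suc; _≤_; _<_; z≤n; s≤s)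
open import Data.Integer as ℤ using (ℤ; +_; -[1+_]; ∣_∣)
import Data.Integer.Properties as ℤP
import Data.Integer.Tactic.RingSolver as ℤSolver
import Data.Nat.Properties as ℕP
import Data.Nat.Tactic.RingSolver as ℕSolver
import Data.Nat.DivMod as ℕDivMod
open import Data.Sign as Sign using ()
open import Data.Maybe using (Maybe; just; nothing)
open import Data.Product using (_×_; _,_)
open import Relation.Nullary using (yes; no)
open import Relation.Binary.Definitions using (tri<; tri≈; tri>)
import Relation.Binary.PropositionalEquality as ≡
open ≡ using (_≡_)
import Algebra.Solver.Ring.AlmostCommutativeRing as ACR
import Algebra.Solver.Ring

module IntegerCoefficientSolver {c ℓ : Level} (R : CommutativeRing c ℓ) where
  open CommutativeRing R
  open import Relation.Binary.Reasoning.Setoid setoid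
  open import Algebra.Properties.Ring ring
    using (-‿involutive; -0#≈0#; -‿distribʳ-*; -‿distribˡ-*; -‿+-comm)
  open import Algebra.Properties.Semiring.Mult.TCOptimised semiring using (1+×; ×-homo-+; ×1-homo-*) renaming (_×_ to _×ᴿ_)

  fromℕ : ℕ → Carrier
  fromℕ n = n ×ᴿ 1#

  fromℤ : ℤ → Carrier
  fromℤ (+ n)    = fromℕ n
  fromℤ -[1+ n ] = - fromℕ (suc n)

  fromℤ-⊖ : ∀ m n → fromℤ (m ℤ.⊖ n) ≈ fromℕ m - fromℕ n
  fromℤ-⊖ m       zero    = trans (sym (+-identityʳ _)) (+-congˡ (sym -0#≈0#))
  fromℤ-⊖ zero    (suc n) = sym (+-identityˡ _)
  fromℤ-⊖ (suc m) (suc n) = begin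
    fromℤ (suc m ℤ.⊖ suc n)                   ≡⟨ ≡.cong fromℤ (ℤP.[1+m]⊖[1+n]≡m⊖n m n) ⟩
    fromℤ (m ℤ.⊖ n)                           ≈⟨ fromℤ-⊖ m n ⟩
    fromℕ m - fromℕ n                         ≈⟨ +-identityˡ _ ⟨
    0# + (fromℕ m - fromℕ n)                  ≈⟨ +-congʳ (-‿inverseʳ 1#) ⟨
    (1# - 1#) + (fromℕ m - fromℕ n)           ≈⟨ +-assoc _ _ _ ⟩
    1# + (- 1# + (fromℕ m - fromℕ n))         ≈⟨ +-congˡ (trans (sym (+-assoc _ _ _)) (trans (+-congʳ (+-comm _ _)) (+-assoc _ _ _))) ⟩
    1# + (fromℕ m + (- 1# - fromℕ n))         ≈⟨ +-assoc _ _ _ ⟨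
    (1# + fromℕ m) + (- 1# - fromℕ n)         ≈⟨ +-congˡ (-‿+-comm _ _) ⟩
    (1# + fromℕ m) - (1# + fromℕ n)           ≈⟨ +-cong (1+× m 1#) (-‿cong (1+× n 1#)) ⟨
    fromℕ (suc m) - fromℕ (suc n)             ∎

  fromℤ-+ : ∀ i j → fromℤ (i ℤ.+ j) ≈ fromℤ i + fromℤ j
  fromℤ-+ (+ m)    (+ n)    = ×-homo-+ 1# m n
  fromℤ-+ (+ m)    -[1+ n ] = fromℤ-⊖ m (suc n)
  fromℤ-+ -[1+ m ] (+ n)    = trans (fromℤ-⊖ n (suc m)) (+-comm _ _)
  fromℤ-+ -[1+ m ] -[1+ n ] = begin
    - fromℕ (suc (suc (m ℕ.+ n)))          ≡⟨ ≡.cong (λ k → - fromℕ (suc k)) (ℕP.+-suc m n) ⟨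
    - fromℕ (suc m ℕ.+ suc n)              ≈⟨ -‿cong (×-homo-+ 1# (suc m) (suc n)) ⟩
    - (fromℕ (suc m) + fromℕ (suc n))      ≈⟨ -‿+-comm _ _ ⟨
    - fromℕ (suc m) + - fromℕ (suc n)      ∎

  private
    fromℤ-+◃ : ∀ n → fromℤ (Sign.+ ℤ.◃ n) ≈ fromℕ n
    fromℤ-+◃ zero    = refl
    fromℤ-+◃ (suc n) = refl

    fromℤ--◃ : ∀ n → fromℤ (Sign.- ℤ.◃ n) ≈ - fromℕ n
    fromℤ--◃ zero    = sym -0#≈0#
    fromℤ--◃ (suc n) = refl

  fromℤ-* : ∀ i j → fromℤ (i ℤ.* j) ≈ fromℤ i * fromℤ j
  fromℤ-* (+ m)    (+ n)    = trans (fromℤ-+◃ (m ℕ.* n)) (×1-homo-* m n)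
  fromℤ-* (+ m)    -[1+ n ] =
    trans (fromℤ--◃ (m ℕ.* suc n)) (trans (-‿cong (×1-homo-* m (suc n))) (-‿distribʳ-* _ _))
  fromℤ-* -[1+ m ] (+ n)    =
    trans (fromℤ--◃ (suc m ℕ.* n)) (trans (-‿cong (×1-homo-* (suc m) n)) (-‿distribˡ-* _ _))
  fromℤ-* -[1+ m ] -[1+ n ] = begin
    fromℤ (Sign.+ ℤ.◃ (suc m ℕ.* suc n))       ≈⟨ fromℤ-+◃ (suc m ℕ.* suc n) ⟩
    fromℕ (suc m ℕ.* suc n)                    ≈⟨ ×1-homo-* (suc m) (suc n) ⟩
    fromℕ (suc m) * fromℕ (suc n)              ≈⟨ -‿involutive _ ⟨
    - - (fromℕ (suc m) * fromℕ (suc n))        ≈⟨ -‿cong (-‿distribʳ-* _ _) ⟩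
    - (fromℕ (suc m) * - fromℕ (suc n))        ≈⟨ -‿distribˡ-* _ _ ⟩
    - fromℕ (suc m) * - fromℕ (suc n)          ∎

  fromℤ-neg : ∀ i → fromℤ (ℤ.- i) ≈ - fromℤ i
  fromℤ-neg (+ zero)  = sym -0#≈0#
  fromℤ-neg (+ suc n) = refl
  fromℤ-neg -[1+ n ]  = sym (-‿involutive _)

  fromℤ-morphism : ACR._-Raw-AlmostCommutative⟶_ (CommutativeRing.rawRing ℤP.+-*-commutativeRing)
                                                  (ACR.fromCommutativeRing R)
  fromℤ-morphism = record
    { ⟦_⟧ = fromℤ ; +-homo = fromℤ-+ ; *-homo = fromℤ-* ; -‿homo = fromℤ-neg
    ; 0-homo = refl ; 1-homo = refl }

  fromℤ-≟ : ∀ i j → Maybe (fromℤ i ≈ fromℤ j)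
  fromℤ-≟ i j with i ℤ.≟ j
  ... | yes ≡.refl = just refl
  ... | no _       = nothing

  open Algebra.Solver.Ring (CommutativeRing.rawRing ℤP.+-*-commutativeRing)
                           (ACR.fromCommutativeRing R) fromℤ-morphism fromℤ-≟ public
    using (solve; _:=_; _:+_; _:*_; :-_; _:-_; con)

-- triangular t = t(t-1)/2, and triangular⊖ t r is (t-r)(t-r-1)/2 evaluated at the integer t - r
triangular : ℕ → ℕ
triangular zero    = 0
triangular (suc t) = triangular t ℕ.+ t

triangular⊖ : ℕ → ℕ → ℕ
triangular⊖ t       zero    = triangular t
triangular⊖ zero    (suc r) = triangular (suc (suc r))
triangular⊖ (suc t) (suc r) = triangular⊖ t r

triangular⊖-suc : ∀ t r → triangular⊖ t (suc r) ℕ.+ t ≡ triangular⊖ t r ℕ.+ suc r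
triangular⊖-suc zero    zero    = ≡.refl
triangular⊖-suc zero    (suc r) = ℕP.+-identityʳ _
triangular⊖-suc (suc t) zero    = ≡.trans (ℕP.+-suc (triangular t) t) (ℕP.+-comm 1 (triangular t ℕ.+ t))
triangular⊖-suc (suc t) (suc r) = ≡.trans (ℕP.+-suc (triangular⊖ t (suc r)) t)
  (≡.trans (≡.cong suc (triangular⊖-suc t r)) (≡.sym (ℕP.+-suc (triangular⊖ t r) (suc r))))

triangular⊖-+ : ∀ p t r → triangular⊖ (p ℕ.+ t) (p ℕ.+ r) ≡ triangular⊖ t r
triangular⊖-+ zero    t r = ≡.refl
triangular⊖-+ (suc p) t r = triangular⊖-+ p t r

triangularℤ : ℤ → ℕ
triangularℤ (+ n)    = triangular n
triangularℤ -[1+ n ] = triangular (suc (suc n))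

triangularℤ-⊖ : ∀ t r → triangularℤ (t ℤ.⊖ r) ≡ triangular⊖ t r
triangularℤ-⊖ t       zero    = ≡.refl
triangularℤ-⊖ zero    (suc r) = ≡.refl
triangularℤ-⊖ (suc t) (suc r) = ≡.trans (≡.cong triangularℤ (ℤP.[1+m]⊖[1+n]≡m⊖n t r)) (triangularℤ-⊖ t r)

-- baileyWeight e j x is invariant under j ↦ -j-e; foldIndex e j is the representative of j in ℕ
foldIndex : ℕ → ℤ → ℕ
foldIndex e       (+ n)    = n
foldIndex zero    -[1+ n ] = suc n
foldIndex (suc _) -[1+ n ] = n

foldExponent : ℕ → ℤ → ℕ
foldExponent e j = foldIndex e j ℕ.* foldIndex e j ℕ.+ e ℕ.* foldIndex e j

triangular-*2 : ∀ n → + (triangular n ℕ.* 2) ≡ + n ℤ.* + n ℤ.- + n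
triangular-*2 zero    = ≡.refl
triangular-*2 (suc n) = begin
  + ((triangular n ℕ.+ n) ℕ.* 2)               ≡⟨ ≡.cong +_ (ℕP.*-distribʳ-+ 2 (triangular n) n) ⟩
  + (triangular n ℕ.* 2 ℕ.+ n ℕ.* 2)           ≡⟨ ℤP.pos-+ (triangular n ℕ.* 2) (n ℕ.* 2) ⟩
  + (triangular n ℕ.* 2) ℤ.+ + (n ℕ.* 2)       ≡⟨ ≡.cong₂ ℤ._+_ (triangular-*2 n) (ℤP.pos-* n 2) ⟩
  (+ n ℤ.* + n ℤ.- + n) ℤ.+ + n ℤ.* + 2        ≡⟨ step (+ n) ⟩
  + suc n ℤ.* + suc n ℤ.- + suc n              ∎
  where
  open ≡.≡-Reasoning
  step : ∀ x → (x ℤ.* x ℤ.- x) ℤ.+ x ℤ.* + 2 ≡ (+ 1 ℤ.+ x) ℤ.* (+ 1 ℤ.+ x) ℤ.- (+ 1 ℤ.+ x)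
  step = ℤSolver.solve-∀

triangularℤ-*2 : ∀ j → + (triangularℤ j ℕ.* 2) ≡ j ℤ.* j ℤ.- j
triangularℤ-*2 (+ n)    = triangular-*2 n
triangularℤ-*2 -[1+ n ] = ≡.trans (triangular-*2 (suc (suc n))) (reflect (+ n))
  where
  reflect : ∀ x → (+ 2 ℤ.+ x) ℤ.* (+ 2 ℤ.+ x) ℤ.- (+ 2 ℤ.+ x) ≡ ℤ.- (+ 1 ℤ.+ x) ℤ.* ℤ.- (+ 1 ℤ.+ x) ℤ.- ℤ.- (+ 1 ℤ.+ x)
  reflect = ℤSolver.solve-∀

pos-foldExponent : ∀ e J → + (J ℕ.* J ℕ.+ e ℕ.* J) ≡ + J ℤ.* + J ℤ.+ + e ℤ.* + J
pos-foldExponent e J = ≡.trans (ℤP.pos-+ (J ℕ.* J) (e ℕ.* J)) (≡.cong₂ ℤ._+_ (ℤP.pos-* J J) (ℤP.pos-* e J))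

foldExponent-ℤ : ∀ e → e ≤ 1 → ∀ j → + foldExponent e j ≡ j ℤ.* j ℤ.+ + e ℤ.* j
foldExponent-ℤ e          _        (+ n)    = pos-foldExponent e n
foldExponent-ℤ zero       _        -[1+ n ] = ≡.trans (pos-foldExponent 0 (suc n)) (reflect (+ suc n))
  where
  reflect : ∀ x → x ℤ.* x ℤ.+ + 0 ℤ.* x ≡ ℤ.- x ℤ.* ℤ.- x ℤ.+ + 0 ℤ.* ℤ.- x
  reflect = ℤSolver.solve-∀
foldExponent-ℤ (suc zero) _        -[1+ n ] = ≡.trans (pos-foldExponent 1 n) (reflect (+ n))
  where
  reflect : ∀ x → x ℤ.* x ℤ.+ + 1 ℤ.* x ≡ ℤ.- (+ 1 ℤ.+ x) ℤ.* ℤ.- (+ 1 ℤ.+ x) ℤ.+ + 1 ℤ.* ℤ.- (+ 1 ℤ.+ x)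
  reflect = ℤSolver.solve-∀
foldExponent-ℤ (suc (suc e)) (s≤s ()) -[1+ n ]

-- The pentagonal exponents (3j² ∓ j)/2 of the statement split as j(j-1)/2 + J(J + e).
pentagonal-*2 : ∀ e → e ≤ 1 → ∀ j →
  + ((triangularℤ j ℕ.+ foldExponent e j) ℕ.* 2) ≡ + 3 ℤ.* j ℤ.* j ℤ.+ (+ e ℤ.+ + e ℤ.- + 1) ℤ.* j
pentagonal-*2 e e≤1 j = begin
  + ((triangularℤ j ℕ.+ foldExponent e j) ℕ.* 2)                ≡⟨ ≡.cong +_ (ℕP.*-distribʳ-+ 2 (triangularℤ j) (foldExponent e j)) ⟩
  + (triangularℤ j ℕ.* 2 ℕ.+ foldExponent e j ℕ.* 2)            ≡⟨ ℤP.pos-+ (triangularℤ j ℕ.* 2) _ ⟩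
  + (triangularℤ j ℕ.* 2) ℤ.+ + (foldExponent e j ℕ.* 2)        ≡⟨ ≡.cong₂ ℤ._+_ (triangularℤ-*2 j)
                                                                     (≡.trans (ℤP.pos-* (foldExponent e j) 2)
                                                                       (≡.cong (ℤ._* + 2) (foldExponent-ℤ e e≤1 j))) ⟩
  (j ℤ.* j ℤ.- j) ℤ.+ (j ℤ.* j ℤ.+ + e ℤ.* j) ℤ.* + 2          ≡⟨ collect j (+ e) ⟩
  + 3 ℤ.* j ℤ.* j ℤ.+ (+ e ℤ.+ + e ℤ.- + 1) ℤ.* j               ∎
  where
  open ≡.≡-Reasoning
  collect : ∀ j x → (j ℤ.* j ℤ.- j) ℤ.+ (j ℤ.* j ℤ.+ x ℤ.* j) ℤ.* + 2 ≡ + 3 ℤ.* j ℤ.* j ℤ.+ (x ℤ.+ x ℤ.- + 1) ℤ.* j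
  collect = ℤSolver.solve-∀

half-abs : ∀ {X z} → + (X ℕ.* 2) ≡ z → ∣ z ∣ ℕDivMod./ 2 ≡ X
half-abs ≡.refl = ℕDivMod.m*n/n≡m _ 2

module Identities {c ℓ : Level} (R : CommutativeRing c ℓ)
                   (q : CommutativeRing.Carrier R) (inv : ℕ → CommutativeRing.Carrier R) where
  open CommutativeRing R
  open QSeries R q inv
  open IntegerCoefficientSolver R
  open import Relation.Binary.Reasoning.Setoid setoid
  open import Algebra.Properties.Ring ring using (-1*x≈-x; -‿involutive; -0#≈0#)

  annihilateˡ : ∀ {x y} → x ≈ 0# → x * y ≈ 0#
  annihilateˡ x≈0 = trans (*-congʳ x≈0) (zeroˡ _)

  annihilateʳ : ∀ {x y} → y ≈ 0# → x * y ≈ 0#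
  annihilateʳ y≈0 = trans (*-congˡ y≈0) (zeroʳ _)

  both-vanish : ∀ {u v w x y} → v ≈ 0# → w ≈ 0# → y ≈ 0# → u * v ≈ w + x * y
  both-vanish v≈0 w≈0 y≈0 = trans (annihilateʳ v≈0) (sym (trans (+-cong w≈0 (annihilateʳ y≈0)) (+-identityʳ 0#)))

  pow-+ : ∀ x m n → pow x (m ℕ.+ n) ≈ pow x m * pow x n
  pow-+ x zero    n = sym (*-identityˡ _)
  pow-+ x (suc m) n = trans (*-congˡ (pow-+ x m n)) (sym (*-assoc _ _ _))

  sign : ℕ → Carrier
  sign = pow (- 1#)

  -1*-1≈1 : - 1# * - 1# ≈ 1#
  -1*-1≈1 = trans (-1*x≈-x _) (-‿involutive _)

  sign-suc : ∀ t → sign (suc t) ≈ - sign t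
  sign-suc t = -1*x≈-x _

  sign-+ : ∀ s t → sign (s ℕ.+ t) ≈ sign s * sign t
  sign-+ = pow-+ (- 1#)

  sgn-⊖ : ∀ t r → sgn (t ℤ.⊖ r) ≈ sign t * sign r
  sgn-⊖ t       zero    = sym (*-identityʳ _)
  sgn-⊖ zero    (suc r) = sym (*-identityˡ _)
  sgn-⊖ (suc t) (suc r) = begin
    sgn (suc t ℤ.⊖ suc r)              ≡⟨ ≡.cong sgn (ℤP.[1+m]⊖[1+n]≡m⊖n t r) ⟩
    sgn (t ℤ.⊖ r)                      ≈⟨ sgn-⊖ t r ⟩
    sign t * sign r                    ≈⟨ *-identityˡ _ ⟨
    1# * (sign t * sign r)             ≈⟨ *-congʳ -1*-1≈1 ⟨
    - 1# * - 1# * (sign t * sign r)    ≈⟨ solve 3 (λ m x y → m :* m :* (x :* y) := m :* x :* (m :* y)) refl _ _ _ ⟩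
    sign (suc t) * sign (suc r)        ∎

  sign-square : ∀ t → sign t * sign t ≈ 1#
  sign-square zero    = *-identityˡ _
  sign-square (suc t) = begin
    - 1# * sign t * (- 1# * sign t)    ≈⟨ solve 2 (λ m x → m :* x :* (m :* x) := m :* m :* (x :* x)) refl _ _ ⟩
    - 1# * - 1# * (sign t * sign t)    ≈⟨ *-cong -1*-1≈1 (sign-square t) ⟩
    1# * 1#                            ≈⟨ *-identityˡ _ ⟩
    1#                                 ∎

  sumℕ-cong : ∀ n {f g : ℕ → Carrier} → (∀ k → k ≤ n → f k ≈ g k) → sumℕ n f ≈ sumℕ n g
  sumℕ-cong zero    f≈g = f≈g 0 z≤n
  sumℕ-cong (suc n) f≈g = +-cong (sumℕ-cong n (λ k k≤n → f≈g k (ℕP.m≤n⇒m≤1+n k≤n))) (f≈g (suc n) ℕP.≤-refl)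

  sumℕ-≈0 : ∀ n {f : ℕ → Carrier} → (∀ k → k ≤ n → f k ≈ 0#) → sumℕ n f ≈ 0#
  sumℕ-≈0 zero    f≈0 = f≈0 0 z≤n
  sumℕ-≈0 (suc n) f≈0 =
    trans (+-cong (sumℕ-≈0 n (λ k k≤n → f≈0 k (ℕP.m≤n⇒m≤1+n k≤n))) (f≈0 (suc n) ℕP.≤-refl)) (+-identityˡ _)

  sumℕ-+ : ∀ n (f g : ℕ → Carrier) → sumℕ n (λ k → f k + g k) ≈ sumℕ n f + sumℕ n g
  sumℕ-+ zero    f g = refl
  sumℕ-+ (suc n) f g = trans (+-congʳ (sumℕ-+ n f g))
    (solve 4 (λ a b x y → a :+ b :+ (x :+ y) := a :+ x :+ (b :+ y)) refl _ _ _ _)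

  *-distribˡ-sumℕ : ∀ n x (f : ℕ → Carrier) → x * sumℕ n f ≈ sumℕ n (λ k → x * f k)
  *-distribˡ-sumℕ zero    x f = refl
  *-distribˡ-sumℕ (suc n) x f = trans (distribˡ _ _ _) (+-congʳ (*-distribˡ-sumℕ n x f))

  sumℕ-linear : ∀ n x y (f g : ℕ → Carrier) →
                sumℕ n (λ k → x * f k - y * g k) ≈ x * sumℕ n f - y * sumℕ n g
  sumℕ-linear zero    x y f g = refl
  sumℕ-linear (suc n) x y f g = trans (+-congʳ (sumℕ-linear n x y f g))
    (solve 6 (λ x y a b c d → x :* a :- y :* b :+ (x :* c :- y :* d) := x :* (a :+ c) :- y :* (b :+ d))
           refl _ _ _ _ _ _)

  sumℕ-head : ∀ n (f : ℕ → Carrier) → sumℕ (suc n) f ≈ f 0 + sumℕ n (λ k → f (suc k))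
  sumℕ-head zero    f = refl
  sumℕ-head (suc n) f = trans (+-congʳ (sumℕ-head n f)) (+-assoc _ _ _)

  sumℕ-swap : ∀ n m (f : ℕ → ℕ → Carrier) →
              sumℕ n (λ i → sumℕ m (f i)) ≈ sumℕ m (λ j → sumℕ n (λ i → f i j))
  sumℕ-swap zero    m f = refl
  sumℕ-swap (suc n) m f = trans (+-congʳ (sumℕ-swap n m f)) (sym (sumℕ-+ m _ _))

  sumℕ-dropˡ : ∀ p n (f : ℕ → Carrier) → (∀ k → k < p → f k ≈ 0#) →
               sumℕ (p ℕ.+ n) f ≈ sumℕ n (λ k → f (p ℕ.+ k))
  sumℕ-dropˡ zero    n f f≈0 = refl
  sumℕ-dropˡ (suc p) n f f≈0 = begin
    sumℕ (suc (p ℕ.+ n)) f                       ≈⟨ sumℕ-head (p ℕ.+ n) f ⟩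
    f 0 + sumℕ (p ℕ.+ n) (λ k → f (suc k))       ≈⟨ +-cong (f≈0 0 (s≤s z≤n))
                                                      (sumℕ-dropˡ p n (λ k → f (suc k)) (λ k k<p → f≈0 (suc k) (s≤s k<p))) ⟩
    0# + sumℕ n (λ k → f (suc p ℕ.+ k))          ≈⟨ +-identityˡ _ ⟩
    sumℕ n (λ k → f (suc p ℕ.+ k))               ∎

  sumℕ-padʳ : ∀ n p {f : ℕ → Carrier} → (∀ k → n < k → f k ≈ 0#) → sumℕ (n ℕ.+ p) f ≈ sumℕ n f
  sumℕ-padʳ n zero    {f} f≈0 = reflexive (≡.cong (λ k → sumℕ k f) (ℕP.+-identityʳ n))
  sumℕ-padʳ n (suc p) {f} f≈0 = begin
    sumℕ (n ℕ.+ suc p) f                      ≡⟨ ≡.cong (λ k → sumℕ k f) (ℕP.+-suc n p) ⟩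
    sumℕ (n ℕ.+ p) f + f (suc (n ℕ.+ p))      ≈⟨ +-cong (sumℕ-padʳ n p f≈0) (f≈0 _ (s≤s (ℕP.m≤m+n n p))) ⟩
    sumℕ n f + 0#                             ≈⟨ +-identityʳ _ ⟩
    sumℕ n f                                  ∎

  sumℕ-dropʳ : ∀ n m {f : ℕ → Carrier} → n ≤ m → (∀ k → n < k → f k ≈ 0#) → sumℕ m f ≈ sumℕ n f
  sumℕ-dropʳ n m {f} n≤m f≈0 =
    trans (reflexive (≡.cong (λ k → sumℕ k f) (≡.sym (ℕP.m+[n∸m]≡n n≤m)))) (sumℕ-padʳ n (m ℕ.∸ n) f≈0)

  previous : (ℕ → Carrier) → ℕ → Carrier
  previous H zero    = 0#
  previous H (suc i) = H i

  sumℕ-telescope : ∀ N (t H : ℕ → Carrier) → (∀ i → i ≤ N → t i ≈ H i - previous H i) → sumℕ N t ≈ H N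
  sumℕ-telescope zero    t H t≈ΔH = trans (t≈ΔH 0 z≤n) (trans (+-congˡ -0#≈0#) (+-identityʳ _))
  sumℕ-telescope (suc N) t H t≈ΔH = begin
    sumℕ N t + t (suc N)            ≈⟨ +-cong (sumℕ-telescope N t H (λ i i≤N → t≈ΔH i (ℕP.m≤n⇒m≤1+n i≤N)))
                                              (t≈ΔH (suc N) ℕP.≤-refl) ⟩
    H N + (H (suc N) - H N)         ≈⟨ solve 2 (λ x y → x :+ (y :- x) := y) refl _ _ ⟩
    H (suc N)                       ∎

  sumℕ-unshift : ∀ n (f : ℕ → Carrier) → f (suc n) ≈ 0# → f 0 + sumℕ n (λ k → f (suc k)) ≈ sumℕ n f
  sumℕ-unshift n f last≈0 = trans (sym (sumℕ-head n f)) (trans (+-congˡ last≈0) (+-identityʳ _))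

  sumFrom-sumℕ : ∀ s c (f : ℤ → Carrier) → sumFrom s (suc c) f ≈ sumℕ c (λ t → f (s ℤ.+ + t))
  sumFrom-sumℕ s zero    f = trans (+-identityʳ _) (reflexive (≡.cong f (≡.sym (ℤP.+-identityʳ s))))
  sumFrom-sumℕ s (suc c) f = begin
    f s + sumFrom (s ℤ.+ + 1) (suc c) f                ≈⟨ +-cong (reflexive (≡.cong f (≡.sym (ℤP.+-identityʳ s))))
                                                                 (sumFrom-sumℕ (s ℤ.+ + 1) c f) ⟩
    f (s ℤ.+ + 0) + sumℕ c (λ t → f (s ℤ.+ + 1 ℤ.+ + t)) ≈⟨ +-congˡ (sumℕ-cong c (λ t _ → reflexive (≡.cong f (ℤP.+-assoc s (+ 1) (+ t))))) ⟩
    f (s ℤ.+ + 0) + sumℕ c (λ t → f (s ℤ.+ + suc t))   ≈⟨ sumℕ-head c _ ⟨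
    sumℕ (suc c) (λ t → f (s ℤ.+ + t))                 ∎

  cancel-unitˡ : ∀ {u v x y} → v * u ≈ 1# → u * x ≈ u * y → x ≈ y
  cancel-unitˡ {u} {v} {x} {y} vu≈1 ux≈uy = begin
    x              ≈⟨ *-identityˡ _ ⟨
    1# * x         ≈⟨ *-congʳ vu≈1 ⟨
    v * u * x      ≈⟨ *-assoc _ _ _ ⟩
    v * (u * x)    ≈⟨ *-congˡ ux≈uy ⟩
    v * (u * y)    ≈⟨ *-assoc _ _ _ ⟨
    v * u * y      ≈⟨ *-congʳ vu≈1 ⟩
    1# * y         ≈⟨ *-identityˡ _ ⟩
    y              ∎

  complement-cong : ∀ {x y} → x ≈ y → 1# - x ≈ 1# - y
  complement-cong x≈y = +-congˡ (-‿cong x≈y)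

  q^_ : ℕ → Carrier
  q^ n = pow q n

  q^-cong : ∀ {m n} → m ≡ n → q^ m ≈ q^ n
  q^-cong m≡n = reflexive (≡.cong q^_ m≡n)

  q^-+ : ∀ m n → q^ (m ℕ.+ n) ≈ q^ m * q^ n
  q^-+ = pow-+ q

  1-q^_ : ℕ → Carrier
  1-q^ n = 1# - q^ n

  1-q^0≈0 : 1-q^ 0 ≈ 0#
  1-q^0≈0 = -‿inverseʳ 1#

  -- 1/(q)_{a-s}, with the statement's convention that it vanishes when s > a
  inv⊖ : ℕ → ℕ → Carrier
  inv⊖ a       zero    = inv a
  inv⊖ zero    (suc s) = 0#
  inv⊖ (suc a) (suc s) = inv⊖ a s

  pinv-⊖ : ∀ a s → pinv (+ a ℤ.- + s) ≡ inv⊖ a s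
  pinv-⊖ a       zero    = ≡.cong (λ k → pinv (+ k)) (ℕP.+-identityʳ a)
  pinv-⊖ zero    (suc s) = ≡.refl
  pinv-⊖ (suc a) (suc s) = ≡.trans (≡.cong pinv suc-a-suc≡a-s) (pinv-⊖ a s)
    where
    suc-a-suc≡a-s : + suc a ℤ.- + suc s ≡ + a ℤ.- + s
    suc-a-suc≡a-s = ≡.trans (ℤP.m-n≡m⊖n (suc a) (suc s))
                    (≡.trans (ℤP.[1+m]⊖[1+n]≡m⊖n a s) (≡.sym (ℤP.m-n≡m⊖n a s)))

  inv⊖-> : ∀ a s → a < s → inv⊖ a s ≈ 0#
  inv⊖-> zero    (suc s) _         = refl
  inv⊖-> (suc a) (suc s) (s≤s a<s) = inv⊖-> a s a<s

  inv⊖-≤ : ∀ a s → s ≤ a → inv⊖ a s ≡ inv (a ℕ.∸ s)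
  inv⊖-≤ a       zero    _         = ≡.refl
  inv⊖-≤ (suc a) (suc s) (s≤s s≤a) = inv⊖-≤ a s s≤a

  inv⊖-+ : ∀ p a s → inv⊖ (p ℕ.+ a) (p ℕ.+ s) ≡ inv⊖ a s
  inv⊖-+ zero    a s = ≡.refl
  inv⊖-+ (suc p) a s = inv⊖-+ p a s

  inv⊖-+ˡ : ∀ p a → inv⊖ (p ℕ.+ a) p ≡ inv a
  inv⊖-+ˡ p a = ≡.trans (≡.cong (inv⊖ (p ℕ.+ a)) (≡.sym (ℕP.+-identityʳ p))) (inv⊖-+ p a 0)

  wz-identity : ∀ W X A Lq Mq Nq →
    (1# - Nq * X) * (1# - Nq * X * A) * (W * (1# - Lq * Mq * Nq * A * X * X))
      - (1# - Mq * Nq * A * X * X) * (1# - Lq * Nq * A * X * X) * (W * (1# - Nq))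
    ≈ - (Nq * A * X * X * (W * ((1# - Lq) * (1# - Mq) * (1# - Nq))))
      - - (Nq * (W * ((1# - X) * (1# - A * X) * (1# - Lq * Mq * Nq * A * X * X))))
  wz-identity W X A Lq Mq Nq = solve 6 (λ W X A Lq Mq Nq →
      (con (+ 1) :- Nq :* X) :* (con (+ 1) :- Nq :* X :* A) :* (W :* (con (+ 1) :- Lq :* Mq :* Nq :* A :* X :* X))
        :- (con (+ 1) :- Mq :* Nq :* A :* X :* X) :* (con (+ 1) :- Lq :* Nq :* A :* X :* X) :* (W :* (con (+ 1) :- Nq))
      := :- (Nq :* A :* X :* X :* (W :* ((con (+ 1) :- Lq) :* (con (+ 1) :- Mq) :* (con (+ 1) :- Nq))))
        :- :- (Nq :* (W :* ((con (+ 1) :- X) :* (con (+ 1) :- A :* X) :* (con (+ 1) :- Lq :* Mq :* Nq :* A :* X :* X)))))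
    refl W X A Lq Mq Nq

  saalschützTerm : ℕ → ℕ → ℕ → ℕ → ℕ → Carrier
  saalschützTerm a l m n i =
    q^ (i ℕ.* i ℕ.+ a ℕ.* i) * poch (l ℕ.+ m ℕ.+ n ℕ.+ a ℕ.∸ i) * inv i * inv (a ℕ.+ i)
    * inv⊖ l i * inv⊖ m i * inv⊖ n i

  saalschützProduct : ℕ → ℕ → ℕ → ℕ → Carrier
  saalschützProduct a l m n =
    poch (l ℕ.+ m ℕ.+ a) * poch (m ℕ.+ n ℕ.+ a) * poch (l ℕ.+ n ℕ.+ a)
    * inv l * inv (l ℕ.+ a) * inv m * inv (m ℕ.+ a) * inv n * inv (n ℕ.+ a)

  vandermondeTerm : ℕ → ℕ → ℕ → ℕ → Carrier
  vandermondeTerm a c e s = q^ ((a ℕ.∸ s) ℕ.* (c ℕ.∸ s)) * inv⊖ a s * inv⊖ c s * inv s * inv (s ℕ.+ e)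

  vandermondeProduct : ℕ → ℕ → ℕ → Carrier
  vandermondeProduct a c e = inv a * inv (a ℕ.+ e) * inv c * inv (c ℕ.+ e) * poch (a ℕ.+ c ℕ.+ e)

  -- The part of (1 - q^{a+1}) * vandermondeTerm (suc a) c e s not divisible by q^c.
  vandermondeCarry : ℕ → ℕ → ℕ → ℕ → Carrier
  vandermondeCarry c       a e zero    = 0#
  vandermondeCarry zero    a e (suc s) = 0#
  vandermondeCarry (suc c) a e (suc s) = vandermondeTerm a c (suc e) s

  vandermondeTerm-≈0ᵃ : ∀ a c e s → inv⊖ a s ≈ 0# → vandermondeTerm a c e s ≈ 0#
  vandermondeTerm-≈0ᵃ a c e s a≈0 = annihilateˡ (annihilateˡ (annihilateˡ (annihilateʳ a≈0)))

  vandermondeTerm-≈0ᶜ : ∀ a c e s → inv⊖ c s ≈ 0# → vandermondeTerm a c e s ≈ 0#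
  vandermondeTerm-≈0ᶜ a c e s c≈0 = annihilateˡ (annihilateˡ (annihilateʳ c≈0))

  -- 1/((q)_t (q)_{M-t}), i.e. the q-binomial coefficient [M, t] divided by (q)_M
  binomialWeight : ℕ → ℕ → Carrier
  binomialWeight M t = inv t * inv⊖ M t

  binomialWeight-> : ∀ M t → M < t → binomialWeight M t ≈ 0#
  binomialWeight-> M t M<t = annihilateʳ (inv⊖-> M t M<t)

  alternatingSum : ℕ → ℕ → Carrier
  alternatingSum M r = sumℕ M (λ t → sign t * q^ (triangular⊖ t r) * binomialWeight M t)

  σ : ℤ → Carrier
  σ j = sgn j * q^ (triangularℤ j)

  baileyWeight : ℕ → ℤ → ℕ → Carrier
  baileyWeight e j x = pinv (+ x ℤ.- j) * pinv (+ x ℤ.+ j ℤ.+ + e)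

  δ₀ : ℕ → Carrier
  δ₀ zero    = 1#
  δ₀ (suc _) = 0#

  σ-⊖ : ∀ t r → σ (t ℤ.⊖ r) ≈ sign t * sign r * q^ (triangular⊖ t r)
  σ-⊖ t r = *-cong (sgn-⊖ t r) (q^-cong (triangularℤ-⊖ t r))

  baileyWeight-⊖ : ∀ e N t K → baileyWeight e (t ℤ.⊖ K) N ≡ inv⊖ (N ℕ.+ K) t * inv⊖ (N ℕ.+ t ℕ.+ e) K
  baileyWeight-⊖ e N t K = ≡.trans (≡.cong (λ j → baileyWeight e j N) (≡.sym (ℤP.m-n≡m⊖n t K))) (≡.cong₂ _*_
    (≡.trans (≡.cong pinv (lower (+ N) (+ t) (+ K))) (pinv-⊖ (N ℕ.+ K) t))
    (≡.trans (≡.cong pinv (upper (+ N) (+ t) (+ K) (+ e))) (pinv-⊖ (N ℕ.+ t ℕ.+ e) K)))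
    where
    lower : ∀ n t k → n ℤ.- (t ℤ.- k) ≡ (n ℤ.+ k) ℤ.- t
    lower = ℤSolver.solve-∀
    upper : ∀ n t k e → n ℤ.+ (t ℤ.- k) ℤ.+ e ≡ (n ℤ.+ t ℤ.+ e) ℤ.- k
    upper = ℤSolver.solve-∀

  unitBaileySummand : ℕ → ℕ → ℕ → ℕ → Carrier
  unitBaileySummand e K N t = σ (t ℤ.⊖ K) * baileyWeight e (t ℤ.⊖ K) N

  unitBaileySummand-shift : ∀ e p N t →
    unitBaileySummand e (p ℕ.+ (N ℕ.+ e)) N (p ℕ.+ t)
      ≈ sign (N ℕ.+ e) * (sign t * q^ (triangular⊖ t (N ℕ.+ e)) * binomialWeight (N ℕ.+ N ℕ.+ e) t)
  unitBaileySummand-shift e p N t = begin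
    unitBaileySummand e (p ℕ.+ K) N (p ℕ.+ t)
      ≈⟨ *-cong (σ-⊖ (p ℕ.+ t) (p ℕ.+ K)) (reflexive (baileyWeight-⊖ e N (p ℕ.+ t) (p ℕ.+ K))) ⟩
    sign (p ℕ.+ t) * sign (p ℕ.+ K) * q^ (triangular⊖ (p ℕ.+ t) (p ℕ.+ K))
      * (inv⊖ (N ℕ.+ (p ℕ.+ K)) (p ℕ.+ t) * inv⊖ (N ℕ.+ (p ℕ.+ t) ℕ.+ e) (p ℕ.+ K))
      ≡⟨ ≡.cong₂ (λ x y → sign (p ℕ.+ t) * sign (p ℕ.+ K) * q^ x * y) (triangular⊖-+ p t K) (≡.cong₂ _*_ lower upper) ⟩
    sign (p ℕ.+ t) * sign (p ℕ.+ K) * q^ (triangular⊖ t K) * (inv⊖ (N ℕ.+ N ℕ.+ e) t * inv t)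
      ≈⟨ *-congʳ (*-congʳ (*-cong (sign-+ p t) (sign-+ p K))) ⟩
    sign p * sign t * (sign p * sign K) * q^ (triangular⊖ t K) * (inv⊖ (N ℕ.+ N ℕ.+ e) t * inv t)
      ≈⟨ solve 6 (λ a b c x D I → a :* b :* (a :* c) :* x :* (D :* I) := a :* a :* (c :* (b :* x :* (I :* D)))) refl _ _ _ _ _ _ ⟩
    sign p * sign p * (sign K * (sign t * q^ (triangular⊖ t K) * binomialWeight (N ℕ.+ N ℕ.+ e) t))
      ≈⟨ trans (*-congʳ (sign-square p)) (*-identityˡ _) ⟩
    sign K * (sign t * q^ (triangular⊖ t K) * binomialWeight (N ℕ.+ N ℕ.+ e) t) ∎
    where
    K : ℕ
    K = N ℕ.+ e
    lower-index : ∀ N p e → N ℕ.+ (p ℕ.+ (N ℕ.+ e)) ≡ p ℕ.+ (N ℕ.+ N ℕ.+ e)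
    lower-index = ℕSolver.solve-∀
    upper-index : ∀ N p t e → N ℕ.+ (p ℕ.+ t) ℕ.+ e ≡ p ℕ.+ (N ℕ.+ e) ℕ.+ t
    upper-index = ℕSolver.solve-∀
    lower : inv⊖ (N ℕ.+ (p ℕ.+ K)) (p ℕ.+ t) ≡ inv⊖ (N ℕ.+ N ℕ.+ e) t
    lower = ≡.trans (≡.cong (λ x → inv⊖ x (p ℕ.+ t)) (lower-index N p e)) (inv⊖-+ p (N ℕ.+ N ℕ.+ e) t)
    upper : inv⊖ (N ℕ.+ (p ℕ.+ t) ℕ.+ e) (p ℕ.+ K) ≡ inv t
    upper = ≡.trans (≡.cong (λ x → inv⊖ x (p ℕ.+ K)) (upper-index N p t e)) (inv⊖-+ˡ (p ℕ.+ K) t)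

  unitBaileySummand-head : ∀ e p N t → t < p → unitBaileySummand e (p ℕ.+ (N ℕ.+ e)) N t ≈ 0#
  unitBaileySummand-head e p N t t<p = annihilateʳ (trans (reflexive (baileyWeight-⊖ e N t (p ℕ.+ (N ℕ.+ e))))
    (annihilateʳ (inv⊖-> (N ℕ.+ t ℕ.+ e) (p ℕ.+ (N ℕ.+ e)) (ℕP.≤-<-trans (ℕP.≤-reflexive (shuffle N t e)) (ℕP.+-monoˡ-< (N ℕ.+ e) t<p)))))
    where
    shuffle : ∀ N t e → N ℕ.+ t ℕ.+ e ≡ t ℕ.+ (N ℕ.+ e)
    shuffle = ℕSolver.solve-∀

  unitBaileySummand-tail : ∀ e p N t → p ℕ.+ (N ℕ.+ N ℕ.+ e) < t → unitBaileySummand e (p ℕ.+ (N ℕ.+ e)) N t ≈ 0#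
  unitBaileySummand-tail e p N t long<t = annihilateʳ (trans (reflexive (baileyWeight-⊖ e N t (p ℕ.+ (N ℕ.+ e))))
    (annihilateˡ (inv⊖-> (N ℕ.+ (p ℕ.+ (N ℕ.+ e))) t (ℕP.≤-trans (ℕP.≤-reflexive (≡.cong suc (shuffle N p e))) long<t))))
    where
    shuffle : ∀ N p e → N ℕ.+ (p ℕ.+ (N ℕ.+ e)) ≡ p ℕ.+ (N ℕ.+ N ℕ.+ e)
    shuffle = ℕSolver.solve-∀

  baileyWeightℕ : ℕ → ℕ → ℕ → Carrier
  baileyWeightℕ e j x = inv⊖ x j * inv (x ℕ.+ j ℕ.+ e)

  baileyWeightℕ-> : ∀ e j x → x < j → baileyWeightℕ e j x ≈ 0#
  baileyWeightℕ-> e j x x<j = annihilateˡ (inv⊖-> x j x<j)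

  baileyWeightℕ-shift : ∀ e j s → baileyWeightℕ e j (j ℕ.+ s) ≡ inv s * inv (s ℕ.+ (j ℕ.+ j ℕ.+ e))
  baileyWeightℕ-shift e j s = ≡.cong₂ (λ x y → x * inv y) (inv⊖-+ˡ j s) (shuffle j s e)
    where
    shuffle : ∀ j s e → j ℕ.+ s ℕ.+ j ℕ.+ e ≡ s ℕ.+ (j ℕ.+ j ℕ.+ e)
    shuffle = ℕSolver.solve-∀

  linearizationCoefficient : ℕ → ℕ → ℕ → Carrier
  linearizationCoefficient k u N = q^ ((k ℕ.∸ N) ℕ.* (u ℕ.∸ N)) * inv (k ℕ.∸ N) * inv⊖ u N

  linearizationCoefficient-shift : ∀ e j a v s → s ≤ a →
    linearizationCoefficient (j ℕ.+ a) (j ℕ.+ v) (j ℕ.+ s) * baileyWeightℕ e j (j ℕ.+ s) ≈ vandermondeTerm a v (j ℕ.+ j ℕ.+ e) s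
  linearizationCoefficient-shift e j a v s s≤a = begin
    q^ ((j ℕ.+ a ℕ.∸ (j ℕ.+ s)) ℕ.* (j ℕ.+ v ℕ.∸ (j ℕ.+ s))) * inv (j ℕ.+ a ℕ.∸ (j ℕ.+ s)) * inv⊖ (j ℕ.+ v) (j ℕ.+ s)
      * baileyWeightℕ e j (j ℕ.+ s)
      ≡⟨ ≡.cong₂ (λ x y → q^ (x ℕ.* y) * inv x * inv⊖ (j ℕ.+ v) (j ℕ.+ s) * baileyWeightℕ e j (j ℕ.+ s))
                 (ℕP.[m+n]∸[m+o]≡n∸o j a s) (ℕP.[m+n]∸[m+o]≡n∸o j v s) ⟩
    q^ ((a ℕ.∸ s) ℕ.* (v ℕ.∸ s)) * inv (a ℕ.∸ s) * inv⊖ (j ℕ.+ v) (j ℕ.+ s) * baileyWeightℕ e j (j ℕ.+ s)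
      ≡⟨ ≡.cong₂ (λ x y → q^ ((a ℕ.∸ s) ℕ.* (v ℕ.∸ s)) * x * inv⊖ (j ℕ.+ v) (j ℕ.+ s) * y)
                 (≡.sym (inv⊖-≤ a s s≤a)) (baileyWeightℕ-shift e j s) ⟩
    q^ ((a ℕ.∸ s) ℕ.* (v ℕ.∸ s)) * inv⊖ a s * inv⊖ (j ℕ.+ v) (j ℕ.+ s) * (inv s * inv (s ℕ.+ (j ℕ.+ j ℕ.+ e)))
      ≡⟨ ≡.cong (λ x → q^ ((a ℕ.∸ s) ℕ.* (v ℕ.∸ s)) * inv⊖ a s * x * (inv s * inv (s ℕ.+ (j ℕ.+ j ℕ.+ e)))) (inv⊖-+ j v s) ⟩
    q^ ((a ℕ.∸ s) ℕ.* (v ℕ.∸ s)) * inv⊖ a s * inv⊖ v s * (inv s * inv (s ℕ.+ (j ℕ.+ j ℕ.+ e)))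
      ≈⟨ *-assoc _ _ _ ⟨
    vandermondeTerm a v (j ℕ.+ j ℕ.+ e) s ∎

  baileyWeight-fold : ∀ e → e ≤ 1 → ∀ j x → baileyWeight e j x ≈ baileyWeightℕ e (foldIndex e j) x
  baileyWeight-fold e _ (+ n) x = *-congʳ (reflexive (pinv-⊖ x n))
  baileyWeight-fold zero _ -[1+ n ] x = begin
    inv (x ℕ.+ suc n) * pinv (+ x ℤ.+ -[1+ n ] ℤ.+ + 0)
      ≡⟨ ≡.cong (λ z → inv (x ℕ.+ suc n) * pinv z) (ℤP.+-identityʳ (+ x ℤ.+ -[1+ n ])) ⟩
    inv (x ℕ.+ suc n) * pinv (+ x ℤ.- + suc n)
      ≡⟨ ≡.cong (inv (x ℕ.+ suc n) *_) (pinv-⊖ x (suc n)) ⟩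
    inv (x ℕ.+ suc n) * inv⊖ x (suc n)
      ≈⟨ *-comm _ _ ⟩
    inv⊖ x (suc n) * inv (x ℕ.+ suc n)
      ≡⟨ ≡.cong (λ z → inv⊖ x (suc n) * inv z) (≡.sym (ℕP.+-identityʳ _)) ⟩
    baileyWeightℕ 0 (suc n) x ∎
  baileyWeight-fold (suc zero) _ -[1+ n ] x = begin
    inv (x ℕ.+ suc n) * pinv (+ x ℤ.+ -[1+ n ] ℤ.+ + 1)
      ≡⟨ ≡.cong (λ z → inv (x ℕ.+ suc n) * pinv z) (reflected (+ x) (+ n)) ⟩
    inv (x ℕ.+ suc n) * pinv (+ x ℤ.- + n)
      ≡⟨ ≡.cong₂ (λ y z → inv y * z) (ℕP.+-suc x n) (pinv-⊖ x n) ⟩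
    inv (suc (x ℕ.+ n)) * inv⊖ x n
      ≈⟨ *-comm _ _ ⟩
    inv⊖ x n * inv (suc (x ℕ.+ n))
      ≡⟨ ≡.cong (λ z → inv⊖ x n * inv z) (ℕP.+-comm 1 (x ℕ.+ n)) ⟩
    baileyWeightℕ 1 n x ∎
    where
    reflected : ∀ x n → x ℤ.+ ℤ.- (+ 1 ℤ.+ n) ℤ.+ + 1 ≡ x ℤ.- n
    reflected = ℤSolver.solve-∀
  baileyWeight-fold (suc (suc e)) (s≤s ()) -[1+ n ] x

  saalschützCoefficient : ℕ → ℕ → ℕ → ℕ → ℕ → Carrier
  saalschützCoefficient e l m n k =
    q^ (k ℕ.* k ℕ.+ e ℕ.* k) * poch (l ℕ.+ m ℕ.+ n ℕ.+ e ℕ.∸ k) * inv⊖ l k * inv⊖ m k * inv⊖ n k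

  pochTriple : ℕ → ℕ → ℕ → ℕ → Carrier
  pochTriple e l m n = poch (l ℕ.+ m ℕ.+ e) * poch (m ℕ.+ n ℕ.+ e) * poch (l ℕ.+ n ℕ.+ e)

  saalschützCoefficient-shift : ∀ e j l₀ m₀ n₀ i →
    saalschützCoefficient e (j ℕ.+ l₀) (j ℕ.+ m₀) (j ℕ.+ n₀) (j ℕ.+ i) * baileyWeightℕ e j (j ℕ.+ i)
      ≈ q^ (j ℕ.* j ℕ.+ e ℕ.* j) * saalschützTerm (j ℕ.+ j ℕ.+ e) l₀ m₀ n₀ i
  saalschützCoefficient-shift e j l₀ m₀ n₀ i = begin
    q^ ((j ℕ.+ i) ℕ.* (j ℕ.+ i) ℕ.+ e ℕ.* (j ℕ.+ i)) * poch (j ℕ.+ l₀ ℕ.+ (j ℕ.+ m₀) ℕ.+ (j ℕ.+ n₀) ℕ.+ e ℕ.∸ (j ℕ.+ i))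
      * inv⊖ (j ℕ.+ l₀) (j ℕ.+ i) * inv⊖ (j ℕ.+ m₀) (j ℕ.+ i) * inv⊖ (j ℕ.+ n₀) (j ℕ.+ i) * baileyWeightℕ e j (j ℕ.+ i)
      ≡⟨ ≡.cong₂ _*_ (≡.cong₂ _*_ (≡.cong₂ _*_ (≡.cong₂ _*_ (≡.cong₂ (λ x y → q^ x * poch y) (exponent j i e) poch-index)
                                                           (inv⊖-+ j l₀ i))
                                               (inv⊖-+ j m₀ i))
                                   (inv⊖-+ j n₀ i))
                     (baileyWeightℕ-shift e j i) ⟩
    q^ (j ℕ.* j ℕ.+ e ℕ.* j ℕ.+ (i ℕ.* i ℕ.+ a ℕ.* i)) * poch (l₀ ℕ.+ m₀ ℕ.+ n₀ ℕ.+ a ℕ.∸ i)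
      * inv⊖ l₀ i * inv⊖ m₀ i * inv⊖ n₀ i * (inv i * inv (i ℕ.+ a))
      ≈⟨ *-cong (*-congʳ (*-congʳ (*-congʳ (*-congʳ (q^-+ (j ℕ.* j ℕ.+ e ℕ.* j) (i ℕ.* i ℕ.+ a ℕ.* i))))))
                (*-congˡ (reflexive (≡.cong inv (ℕP.+-comm i a)))) ⟩
    q^ (j ℕ.* j ℕ.+ e ℕ.* j) * q^ (i ℕ.* i ℕ.+ a ℕ.* i) * poch (l₀ ℕ.+ m₀ ℕ.+ n₀ ℕ.+ a ℕ.∸ i)
      * inv⊖ l₀ i * inv⊖ m₀ i * inv⊖ n₀ i * (inv i * inv (a ℕ.+ i))
      ≈⟨ solve 8 (λ w x p d₁ d₂ d₃ i₁ i₂ → w :* x :* p :* d₁ :* d₂ :* d₃ :* (i₁ :* i₂)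
                                          := w :* (x :* p :* i₁ :* i₂ :* d₁ :* d₂ :* d₃)) refl _ _ _ _ _ _ _ _ ⟩
    q^ (j ℕ.* j ℕ.+ e ℕ.* j) * saalschützTerm a l₀ m₀ n₀ i ∎
    where
    a : ℕ
    a = j ℕ.+ j ℕ.+ e
    exponent : ∀ j i e → (j ℕ.+ i) ℕ.* (j ℕ.+ i) ℕ.+ e ℕ.* (j ℕ.+ i) ≡ j ℕ.* j ℕ.+ e ℕ.* j ℕ.+ (i ℕ.* i ℕ.+ (j ℕ.+ j ℕ.+ e) ℕ.* i)
    exponent = ℕSolver.solve-∀
    total : ∀ j l₀ m₀ n₀ e → j ℕ.+ l₀ ℕ.+ (j ℕ.+ m₀) ℕ.+ (j ℕ.+ n₀) ℕ.+ e ≡ j ℕ.+ (l₀ ℕ.+ m₀ ℕ.+ n₀ ℕ.+ (j ℕ.+ j ℕ.+ e))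
    total = ℕSolver.solve-∀
    poch-index : j ℕ.+ l₀ ℕ.+ (j ℕ.+ m₀) ℕ.+ (j ℕ.+ n₀) ℕ.+ e ℕ.∸ (j ℕ.+ i) ≡ l₀ ℕ.+ m₀ ℕ.+ n₀ ℕ.+ a ℕ.∸ i
    poch-index = ≡.trans (≡.cong (ℕ._∸ (j ℕ.+ i)) (total j l₀ m₀ n₀ e)) (ℕP.[m+n]∸[m+o]≡n∸o j _ i)

  saalschützProduct-shift : ∀ e j l₀ m₀ n₀ →
    saalschützProduct (j ℕ.+ j ℕ.+ e) l₀ m₀ n₀
      ≈ pochTriple e (j ℕ.+ l₀) (j ℕ.+ m₀) (j ℕ.+ n₀)
        * baileyWeightℕ e j (j ℕ.+ l₀) * baileyWeightℕ e j (j ℕ.+ m₀) * baileyWeightℕ e j (j ℕ.+ n₀)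
  saalschützProduct-shift e j l₀ m₀ n₀ = begin
    saalschützProduct a l₀ m₀ n₀
      ≈⟨ solve 9 (λ p₁ p₂ p₃ i₁ i₂ i₃ i₄ i₅ i₆ → p₁ :* p₂ :* p₃ :* i₁ :* i₂ :* i₃ :* i₄ :* i₅ :* i₆
                                                := p₁ :* p₂ :* p₃ :* (i₁ :* i₂) :* (i₃ :* i₄) :* (i₅ :* i₆)) refl _ _ _ _ _ _ _ _ _ ⟩
    poch (l₀ ℕ.+ m₀ ℕ.+ a) * poch (m₀ ℕ.+ n₀ ℕ.+ a) * poch (l₀ ℕ.+ n₀ ℕ.+ a)
      * (inv l₀ * inv (l₀ ℕ.+ a)) * (inv m₀ * inv (m₀ ℕ.+ a)) * (inv n₀ * inv (n₀ ℕ.+ a))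
      ≡⟨ ≡.cong₂ _*_ (≡.cong₂ _*_ (≡.cong₂ _*_
           (≡.cong₂ _*_ (≡.cong₂ _*_ (≡.cong poch (pair l₀ m₀)) (≡.cong poch (pair m₀ n₀))) (≡.cong poch (pair l₀ n₀)))
           (≡.sym (baileyWeightℕ-shift e j l₀))) (≡.sym (baileyWeightℕ-shift e j m₀))) (≡.sym (baileyWeightℕ-shift e j n₀)) ⟩
    pochTriple e (j ℕ.+ l₀) (j ℕ.+ m₀) (j ℕ.+ n₀)
      * baileyWeightℕ e j (j ℕ.+ l₀) * baileyWeightℕ e j (j ℕ.+ m₀) * baileyWeightℕ e j (j ℕ.+ n₀) ∎
    where
    a : ℕ
    a = j ℕ.+ j ℕ.+ e
    shuffle : ∀ j x y e → x ℕ.+ y ℕ.+ (j ℕ.+ j ℕ.+ e) ≡ j ℕ.+ x ℕ.+ (j ℕ.+ y) ℕ.+ e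
    shuffle = ℕSolver.solve-∀
    pair : ∀ x y → x ℕ.+ y ℕ.+ a ≡ j ℕ.+ x ℕ.+ (j ℕ.+ y) ℕ.+ e
    pair x y = shuffle j x y e

  saalschützCoefficient*baileyWeightℕ-≈0 : ∀ e j l m n k → (∀ k → j ≤ k → saalschützCoefficient e l m n k ≈ 0#) →
                                           saalschützCoefficient e l m n k * baileyWeightℕ e j k ≈ 0#
  saalschützCoefficient*baileyWeightℕ-≈0 e j l m n k coefficient≈0 with k ℕP.<? j
  ... | yes k<j = annihilateʳ (baileyWeightℕ-> e j k k<j)
  ... | no  k≮j = annihilateˡ (coefficient≈0 k (ℕP.≮⇒≥ k≮j))

  baileyLHS : ℕ → ℕ → ℕ → ℕ → ℕ → Carrier
  baileyLHS e l m n u = sumℕ n (λ k → saalschützCoefficient e l m n k * (q^ (k ℕ.* u) * inv k * inv (k ℕ.+ u ℕ.+ e)))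

  baileyRHS : ℕ → ℕ → ℕ → ℕ → ℕ → Carrier
  baileyRHS e l m n u = sumℕ (n ℕ.+ n ℕ.+ e) (λ t → let j = t ℤ.⊖ (n ℕ.+ e) in
    σ j * q^ (foldExponent e j) * pochTriple e l m n * poch u
    * baileyWeight e j l * baileyWeight e j m * baileyWeight e j n * baileyWeight e j u)

  sumℤ-sumℕ : ∀ K L (f : ℤ → Carrier) → sumℤ (ℤ.- (+ K)) (+ L) f ≈ sumℕ (L ℕ.+ K) (λ t → f (t ℤ.⊖ K))
  sumℤ-sumℕ K L f = begin
    sumFrom (ℤ.- (+ K)) ∣ + L ℤ.- ℤ.- (+ K) ℤ.+ + 1 ∣ f   ≡⟨ ≡.cong (λ c → sumFrom (ℤ.- (+ K)) ∣ c ∣ f) (count (+ L) (+ K)) ⟩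
    sumFrom (ℤ.- (+ K)) (suc (L ℕ.+ K)) f              ≈⟨ sumFrom-sumℕ (ℤ.- (+ K)) (L ℕ.+ K) f ⟩
    sumℕ (L ℕ.+ K) (λ t → f (ℤ.- (+ K) ℤ.+ + t))       ≈⟨ sumℕ-cong (L ℕ.+ K) (λ t _ → reflexive (≡.cong f (ℤP.-m+n≡n⊖m K t))) ⟩
    sumℕ (L ℕ.+ K) (λ t → f (t ℤ.⊖ K))                 ∎
    where
    count : ∀ x y → x ℤ.- ℤ.- y ℤ.+ + 1 ≡ + 1 ℤ.+ (x ℤ.+ y)
    count = ℤSolver.solve-∀

  sumℤ-baileyRange : ∀ e n {a} (f : ℤ → Carrier) → a ≡ ℤ.- (+ (n ℕ.+ e)) →
                     sumℤ a (+ n) f ≈ sumℕ (n ℕ.+ n ℕ.+ e) (λ t → f (t ℤ.⊖ (n ℕ.+ e)))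
  sumℤ-baileyRange e n f ≡.refl = trans (sumℤ-sumℕ (n ℕ.+ e) n f)
    (reflexive (≡.cong (λ x → sumℕ x (λ t → f (t ℤ.⊖ (n ℕ.+ e)))) (≡.sym (ℕP.+-assoc n n e))))

  lhs-summand : ∀ e l m n u k {E P U} → E ≡ k ℕ.* k ℕ.+ e ℕ.* k ℕ.+ k ℕ.* u → P ≡ l ℕ.+ m ℕ.+ n ℕ.+ e ℕ.∸ k →
    U ≡ k ℕ.+ u ℕ.+ e →
    q^ E * poch P * inv k * pinv (+ l ℤ.- + k) * pinv (+ m ℤ.- + k) * pinv (+ n ℤ.- + k) * inv U
      ≈ saalschützCoefficient e l m n k * (q^ (k ℕ.* u) * inv k * inv (k ℕ.+ u ℕ.+ e))
  lhs-summand e l m n u k ≡.refl ≡.refl ≡.refl = begin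
    q^ (k ℕ.* k ℕ.+ e ℕ.* k ℕ.+ k ℕ.* u) * poch P * inv k * pinv (+ l ℤ.- + k) * pinv (+ m ℤ.- + k) * pinv (+ n ℤ.- + k) * inv U
      ≡⟨ ≡.cong₂ (λ x y → q^ (k ℕ.* k ℕ.+ e ℕ.* k ℕ.+ k ℕ.* u) * poch P * inv k * x * y * pinv (+ n ℤ.- + k) * inv U)
                 (pinv-⊖ l k) (pinv-⊖ m k) ⟩
    q^ (k ℕ.* k ℕ.+ e ℕ.* k ℕ.+ k ℕ.* u) * poch P * inv k * inv⊖ l k * inv⊖ m k * pinv (+ n ℤ.- + k) * inv U
      ≡⟨ ≡.cong (λ x → q^ (k ℕ.* k ℕ.+ e ℕ.* k ℕ.+ k ℕ.* u) * poch P * inv k * inv⊖ l k * inv⊖ m k * x * inv U)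
                (pinv-⊖ n k) ⟩
    q^ (k ℕ.* k ℕ.+ e ℕ.* k ℕ.+ k ℕ.* u) * poch P * inv k * inv⊖ l k * inv⊖ m k * inv⊖ n k * inv U
      ≈⟨ *-congʳ (*-congʳ (*-congʳ (*-congʳ (*-congʳ (*-congʳ (q^-+ (k ℕ.* k ℕ.+ e ℕ.* k) (k ℕ.* u))))))) ⟩
    q^ (k ℕ.* k ℕ.+ e ℕ.* k) * q^ (k ℕ.* u) * poch P * inv k * inv⊖ l k * inv⊖ m k * inv⊖ n k * inv U
      ≈⟨ solve 8 (λ a b p i d₁ d₂ d₃ j → a :* b :* p :* i :* d₁ :* d₂ :* d₃ :* j
                                        := a :* p :* d₁ :* d₂ :* d₃ :* (b :* i :* j)) refl _ _ _ _ _ _ _ _ ⟩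
    saalschützCoefficient e l m n k * (q^ (k ℕ.* u) * inv k * inv U) ∎
    where
    P U : ℕ
    P = l ℕ.+ m ℕ.+ n ℕ.+ e ℕ.∸ k
    U = k ℕ.+ u ℕ.+ e

  lhs1-as-bailey : ∀ l m n u → lhs1 l m n u ≈ baileyLHS 0 l m n u
  lhs1-as-bailey l m n u = sumℕ-cong n (λ k _ →
    lhs-summand 0 l m n u k (exponent k u) (≡.cong (ℕ._∸ k) (≡.sym (ℕP.+-identityʳ (l ℕ.+ m ℕ.+ n)))) (index u k))
    where
    exponent : ∀ k u → k ℕ.* k ℕ.+ u ℕ.* k ≡ k ℕ.* k ℕ.+ 0 ℕ.* k ℕ.+ k ℕ.* u
    exponent = ℕSolver.solve-∀
    index : ∀ u k → u ℕ.+ k ≡ k ℕ.+ u ℕ.+ 0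
    index = ℕSolver.solve-∀

  lhs2-as-bailey : ∀ l m n u → lhs2 l m n u ≈ baileyLHS 1 l m n u
  lhs2-as-bailey l m n u = sumℕ-cong n (λ k k≤n →
    lhs-summand 1 l m n u k (exponent k u) (≡.sym (ℕP.+-∸-comm 1 (ℕP.≤-trans k≤n (ℕP.m≤n+m n (l ℕ.+ m))))) (index u k))
    where
    exponent : ∀ k u → k ℕ.* k ℕ.+ (u ℕ.+ 1) ℕ.* k ≡ k ℕ.* k ℕ.+ 1 ℕ.* k ℕ.+ k ℕ.* u
    exponent = ℕSolver.solve-∀
    index : ∀ u k → u ℕ.+ k ℕ.+ 1 ≡ k ℕ.+ u ℕ.+ 1
    index = ℕSolver.solve-∀

  rhs-summand : ∀ e l m n u j {Pₗₘ Pₘₙ Pₗₙ Xₗ Xₘ Xₙ Xᵤ s s′} →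
    Pₗₘ ≡ l ℕ.+ m ℕ.+ e → Pₘₙ ≡ m ℕ.+ n ℕ.+ e → Pₗₙ ≡ l ℕ.+ n ℕ.+ e →
    Xₗ ≡ + l ℤ.+ j ℤ.+ + e → Xₘ ≡ + m ℤ.+ j ℤ.+ + e → Xₙ ≡ + n ℤ.+ j ℤ.+ + e → Xᵤ ≡ + u ℤ.+ j ℤ.+ + e → s ≈ s′ →
    s * poch Pₗₘ * poch Pₘₙ * poch Pₗₙ * poch u
      * pinv (+ l ℤ.- j) * pinv (+ m ℤ.- j) * pinv (+ n ℤ.- j) * pinv (+ u ℤ.- j)
      * pinv Xₗ * pinv Xₘ * pinv Xₙ * pinv Xᵤ
    ≈ s′ * pochTriple e l m n * poch u
      * baileyWeight e j l * baileyWeight e j m * baileyWeight e j n * baileyWeight e j u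
  rhs-summand e l m n u j {s = s} {s′} ≡.refl ≡.refl ≡.refl ≡.refl ≡.refl ≡.refl ≡.refl s≈s′ = begin
    s * Pₗₘ * Pₘₙ * Pₗₙ * Pᵤ * Lₗ * Lₘ * Lₙ * Lᵤ * Rₗ * Rₘ * Rₙ * Rᵤ
      ≈⟨ solve 13 (λ s p₁ p₂ p₃ pᵤ l₁ l₂ l₃ l₄ r₁ r₂ r₃ r₄ →
                     s :* p₁ :* p₂ :* p₃ :* pᵤ :* l₁ :* l₂ :* l₃ :* l₄ :* r₁ :* r₂ :* r₃ :* r₄
                     := s :* ((p₁ :* p₂ :* p₃) :* pᵤ :* (l₁ :* r₁) :* (l₂ :* r₂) :* (l₃ :* r₃) :* (l₄ :* r₄)))
                 refl s Pₗₘ Pₘₙ Pₗₙ Pᵤ Lₗ Lₘ Lₙ Lᵤ Rₗ Rₘ Rₙ Rᵤ ⟩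
    s * ((Pₗₘ * Pₘₙ * Pₗₙ) * Pᵤ * (Lₗ * Rₗ) * (Lₘ * Rₘ) * (Lₙ * Rₙ) * (Lᵤ * Rᵤ))
      ≈⟨ *-congʳ s≈s′ ⟩
    s′ * ((Pₗₘ * Pₘₙ * Pₗₙ) * Pᵤ * (Lₗ * Rₗ) * (Lₘ * Rₘ) * (Lₙ * Rₙ) * (Lᵤ * Rᵤ))
      ≈⟨ solve 7 (λ s p pᵤ a b c d → s :* (p :* pᵤ :* a :* b :* c :* d) := s :* p :* pᵤ :* a :* b :* c :* d)
                 refl s′ (Pₗₘ * Pₘₙ * Pₗₙ) Pᵤ (Lₗ * Rₗ) (Lₘ * Rₘ) (Lₙ * Rₙ) (Lᵤ * Rᵤ) ⟩
    s′ * pochTriple e l m n * poch u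
      * baileyWeight e j l * baileyWeight e j m * baileyWeight e j n * baileyWeight e j u ∎
    where
    Pₗₘ Pₘₙ Pₗₙ Pᵤ Lₗ Lₘ Lₙ Lᵤ Rₗ Rₘ Rₙ Rᵤ : Carrier
    Pₗₘ = poch (l ℕ.+ m ℕ.+ e)
    Pₘₙ = poch (m ℕ.+ n ℕ.+ e)
    Pₗₙ = poch (l ℕ.+ n ℕ.+ e)
    Pᵤ  = poch u
    Lₗ  = pinv (+ l ℤ.- j)
    Lₘ  = pinv (+ m ℤ.- j)
    Lₙ  = pinv (+ n ℤ.- j)
    Lᵤ  = pinv (+ u ℤ.- j)
    Rₗ  = pinv (+ l ℤ.+ j ℤ.+ + e)
    Rₘ  = pinv (+ m ℤ.+ j ℤ.+ + e)
    Rₙ  = pinv (+ n ℤ.+ j ℤ.+ + e)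
    Rᵤ  = pinv (+ u ℤ.+ j ℤ.+ + e)

  sign-pentagonal : ∀ e j {P} → P ≡ triangularℤ j ℕ.+ foldExponent e j → sgn j * q^ P ≈ σ j * q^ (foldExponent e j)
  sign-pentagonal e j ≡.refl = trans (*-congˡ (q^-+ (triangularℤ j) (foldExponent e j))) (sym (*-assoc _ _ _))

  pentM-split : ∀ j → pentM j ≡ triangularℤ j ℕ.+ foldExponent 0 j
  pentM-split j = half-abs (≡.trans (pentagonal-*2 0 z≤n j) (simplify j))
    where
    simplify : ∀ j → + 3 ℤ.* j ℤ.* j ℤ.+ (+ 0 ℤ.+ + 0 ℤ.- + 1) ℤ.* j ≡ + 3 ℤ.* j ℤ.* j ℤ.- j
    simplify = ℤSolver.solve-∀

  pentP-split : ∀ j → pentP j ≡ triangularℤ j ℕ.+ foldExponent 1 j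
  pentP-split j = half-abs (≡.trans (pentagonal-*2 1 ℕP.≤-refl j) (simplify j))
    where
    simplify : ∀ j → + 3 ℤ.* j ℤ.* j ℤ.+ (+ 1 ℤ.+ + 1 ℤ.- + 1) ℤ.* j ≡ + 3 ℤ.* j ℤ.* j ℤ.+ j
    simplify = ℤSolver.solve-∀

  rhs1-as-bailey : ∀ l m n u → rhs1 l m n u ≈ baileyRHS 0 l m n u
  rhs1-as-bailey l m n u = trans (sumℤ-baileyRange 0 n _ (≡.cong (λ x → ℤ.- (+ x)) (≡.sym (ℕP.+-identityʳ n))))
    (sumℕ-cong (n ℕ.+ n ℕ.+ 0) (λ t _ → let j = t ℤ.⊖ (n ℕ.+ 0) in rhs-summand 0 l m n u j
      (plus-0 (l ℕ.+ m)) (plus-0 (m ℕ.+ n)) (plus-0 (l ℕ.+ n)) (plus-+0 l j) (plus-+0 m j) (plus-+0 n j) (plus-+0 u j)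
      (sign-pentagonal 0 j (pentM-split j))))
    where
    plus-0 : ∀ x → x ≡ x ℕ.+ 0
    plus-0 x = ≡.sym (ℕP.+-identityʳ x)
    plus-+0 : ∀ x j → + x ℤ.+ j ≡ + x ℤ.+ j ℤ.+ + 0
    plus-+0 x j = ≡.sym (ℤP.+-identityʳ (+ x ℤ.+ j))

  rhs2-as-bailey : ∀ l m n u → rhs2 l m n u ≈ baileyRHS 1 l m n u
  rhs2-as-bailey l m n u = trans (sumℤ-baileyRange 1 n _ (lower (+ n)))
    (sumℕ-cong (n ℕ.+ n ℕ.+ 1) (λ t _ → rhs-summand 1 l m n u (t ℤ.⊖ (n ℕ.+ 1))
      ≡.refl ≡.refl ≡.refl ≡.refl ≡.refl ≡.refl ≡.refl (sign-pentagonal 1 (t ℤ.⊖ (n ℕ.+ 1)) (pentP-split (t ℤ.⊖ (n ℕ.+ 1))))))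
    where
    lower : ∀ x → ℤ.- x ℤ.- + 1 ≡ ℤ.- (x ℤ.+ + 1)
    lower = ℤSolver.solve-∀

  module _ (inv-poch : ∀ N → inv N * poch N ≈ 1#) where

    inv-0 : inv 0 ≈ 1#
    inv-0 = trans (sym (*-identityʳ _)) (inv-poch 0)

    poch-inv : ∀ N → poch N * inv N ≈ 1#
    poch-inv N = trans (*-comm _ _) (inv-poch N)

    inv-suc : ∀ N → inv (suc N) * 1-q^ (suc N) ≈ inv N
    inv-suc N = begin
      inv (suc N) * 1-q^ (suc N)                    ≈⟨ *-identityʳ _ ⟨
      inv (suc N) * 1-q^ (suc N) * 1#               ≈⟨ *-congˡ (inv-poch N) ⟨
      inv (suc N) * 1-q^ (suc N) * (inv N * poch N) ≈⟨ solve 4 (λ a b x y → a :* b :* (x :* y) := a :* (y :* b) :* x) refl _ _ _ _ ⟩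
      inv (suc N) * poch (suc N) * inv N            ≈⟨ *-congʳ (inv-poch (suc N)) ⟩
      1# * inv N                                    ≈⟨ *-identityˡ _ ⟩
      inv N                                         ∎

    poch-cancelˡ : ∀ N {x y} → poch N * x ≈ poch N * y → x ≈ y
    poch-cancelˡ N = cancel-unitˡ (inv-poch N)

    1-q^-cancelˡ : ∀ N {x y} → 1-q^ (suc N) * x ≈ 1-q^ (suc N) * y → x ≈ y
    1-q^-cancelˡ N = cancel-unitˡ (trans (*-assoc _ _ _) (inv-poch (suc N)))

    inv⊖-sucˡ : ∀ a s → inv⊖ a s ≈ inv⊖ (suc a) s * 1-q^ (suc a ℕ.∸ s)
    inv⊖-sucˡ a       zero          = sym (inv-suc a)
    inv⊖-sucˡ zero    (suc zero)    = sym (annihilateʳ 1-q^0≈0)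
    inv⊖-sucˡ zero    (suc (suc s)) = sym (zeroˡ _)
    inv⊖-sucˡ (suc a) (suc s)       = inv⊖-sucˡ a s

    inv⊖-sucʳ : ∀ a s → inv⊖ a (suc s) ≈ inv⊖ a s * 1-q^ (a ℕ.∸ s)
    inv⊖-sucʳ zero    zero    = sym (annihilateʳ 1-q^0≈0)
    inv⊖-sucʳ zero    (suc s) = sym (zeroˡ _)
    inv⊖-sucʳ (suc a) zero    = sym (inv-suc a)
    inv⊖-sucʳ (suc a) (suc s) = inv⊖-sucʳ a s

    module SaalschützRecurrence (a l m n : ℕ) where
      L : ℕ
      L = l ℕ.+ m ℕ.+ n ℕ.+ a

      c₁ c₂ : Carrier
      c₁ = 1-q^ (suc n) * 1-q^ (suc (n ℕ.+ a))
      c₂ = 1-q^ (suc (m ℕ.+ n ℕ.+ a)) * 1-q^ (suc (l ℕ.+ n ℕ.+ a))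

      difference : ℕ → Carrier
      difference i = c₁ * saalschützTerm a l m (suc n) i - c₂ * saalschützTerm a l m n i

      certificate : ℕ → Carrier
      certificate i = - (q^ (i ℕ.* i ℕ.+ a ℕ.* i) * q^ (suc (n ℕ.+ a ℕ.+ i)) * poch (L ℕ.∸ i) * inv i * inv (a ℕ.+ i)
                         * inv⊖ l (suc i) * inv⊖ m (suc i) * inv⊖ n i)

      weight : ℕ → Carrier
      weight i = q^ (i ℕ.* i ℕ.+ a ℕ.* i) * poch (L ℕ.∸ i) * inv i * inv (a ℕ.+ i)
                 * inv⊖ l i * inv⊖ m i * inv⊖ (suc n) i

      difference-of-zeros : ∀ i → (∀ n′ → saalschützTerm a l m n′ i ≈ 0#) →
                            certificate i ≈ 0# → previous certificate i ≈ 0# →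
                            difference i ≈ certificate i - previous certificate i
      difference-of-zeros i F≈0 H≈0 H′≈0 = begin
        difference i                          ≈⟨ +-cong (annihilateʳ (F≈0 (suc n))) (-‿cong (annihilateʳ (F≈0 n))) ⟩
        0# - 0#                               ≈⟨ +-cong H≈0 (-‿cong H′≈0) ⟨
        certificate i - previous certificate i ∎

      certificate-≈0ˡ : ∀ i → l < suc i → certificate i ≈ 0#
      certificate-≈0ˡ i l<1+i =
        trans (-‿cong (annihilateˡ (annihilateˡ (annihilateʳ (inv⊖-> l (suc i) l<1+i))))) -0#≈0#

      certificate-≈0ᵐ : ∀ i → m < suc i → certificate i ≈ 0#
      certificate-≈0ᵐ i m<1+i =
        trans (-‿cong (annihilateˡ (annihilateʳ (inv⊖-> m (suc i) m<1+i)))) -0#≈0#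

      telescopes-beyond-l : ∀ i → l < i → difference i ≈ certificate i - previous certificate i
      telescopes-beyond-l (suc i) l<1+i = difference-of-zeros (suc i)
        (λ _ → annihilateˡ (annihilateˡ (annihilateʳ (inv⊖-> l (suc i) l<1+i))))
        (certificate-≈0ˡ (suc i) (ℕP.m<n⇒m<1+n l<1+i)) (certificate-≈0ˡ i l<1+i)

      telescopes-beyond-m : ∀ i → m < i → difference i ≈ certificate i - previous certificate i
      telescopes-beyond-m (suc i) m<1+i = difference-of-zeros (suc i)
        (λ _ → annihilateˡ (annihilateʳ (inv⊖-> m (suc i) m<1+i)))
        (certificate-≈0ᵐ (suc i) (ℕP.m<n⇒m<1+n m<1+i)) (certificate-≈0ᵐ i m<1+i)

      i≤l⇒i≤L : ∀ {i} → i ≤ l → i ≤ L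
      i≤l⇒i≤L i≤l = ℕP.≤-trans i≤l (ℕP.≤-trans (ℕP.m≤m+n l m) (ℕP.≤-trans (ℕP.m≤m+n (l ℕ.+ m) n) (ℕP.m≤m+n (l ℕ.+ m ℕ.+ n) a)))

      previous-certificate : ∀ i → i ≤ l → i ≤ suc n →
        previous certificate i ≈ - (q^ (suc n ℕ.∸ i) * (weight i * (1-q^ i * 1-q^ (a ℕ.+ i) * 1-q^ (suc (L ℕ.∸ i)))))
      previous-certificate zero    _ _ =
        sym (trans (-‿cong (annihilateʳ (annihilateʳ (annihilateˡ (annihilateˡ 1-q^0≈0))))) -0#≈0#)
      previous-certificate (suc j) 1+j≤l (s≤s j≤n) = -‿cong (begin
        q^ (j ℕ.* j ℕ.+ a ℕ.* j) * q^ (suc (n ℕ.+ a ℕ.+ j)) * poch (L ℕ.∸ j) * inv j * inv (a ℕ.+ j)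
          * inv⊖ l (suc j) * inv⊖ m (suc j) * inv⊖ n j
          ≈⟨ *-congʳ (*-congʳ (*-congʳ (*-cong (*-cong (*-cong exponents poch-L) (sym (inv-suc j))) inv-a))) ⟩
        q^ (suc j ℕ.* suc j ℕ.+ a ℕ.* suc j) * q^ (n ℕ.∸ j) * (poch (L ℕ.∸ suc j) * 1-q^ (suc (L ℕ.∸ suc j)))
          * (inv (suc j) * 1-q^ (suc j)) * (inv (a ℕ.+ suc j) * 1-q^ (a ℕ.+ suc j))
          * inv⊖ l (suc j) * inv⊖ m (suc j) * inv⊖ (suc n) (suc j)
          ≈⟨ solve 11 (λ e nq p dL x3 di x4 da x5 x6 x7 →
               e :* nq :* (p :* dL) :* (x3 :* di) :* (x4 :* da) :* x5 :* x6 :* x7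
               := nq :* (e :* p :* x3 :* x4 :* x5 :* x6 :* x7 :* (di :* da :* dL))) refl _ _ _ _ _ _ _ _ _ _ _ ⟩
        q^ (n ℕ.∸ j) * (weight (suc j) * (1-q^ (suc j) * 1-q^ (a ℕ.+ suc j) * 1-q^ (suc (L ℕ.∸ suc j)))) ∎)
        where
        exponent-sum : ∀ j a k → j ℕ.* j ℕ.+ a ℕ.* j ℕ.+ suc (k ℕ.+ j ℕ.+ a ℕ.+ j) ≡ suc j ℕ.* suc j ℕ.+ a ℕ.* suc j ℕ.+ k
        exponent-sum = ℕSolver.solve-∀
        exponents : q^ (j ℕ.* j ℕ.+ a ℕ.* j) * q^ (suc (n ℕ.+ a ℕ.+ j)) ≈ q^ (suc j ℕ.* suc j ℕ.+ a ℕ.* suc j) * q^ (n ℕ.∸ j)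
        exponents = begin
          q^ (j ℕ.* j ℕ.+ a ℕ.* j) * q^ (suc (n ℕ.+ a ℕ.+ j))        ≈⟨ q^-+ (j ℕ.* j ℕ.+ a ℕ.* j) _ ⟨
          q^ (j ℕ.* j ℕ.+ a ℕ.* j ℕ.+ suc (n ℕ.+ a ℕ.+ j))          ≡⟨ ≡.cong (λ k → q^ (j ℕ.* j ℕ.+ a ℕ.* j ℕ.+ suc (k ℕ.+ a ℕ.+ j)))
                                                                        (≡.sym (ℕP.m∸n+n≡m j≤n)) ⟩
          q^ (j ℕ.* j ℕ.+ a ℕ.* j ℕ.+ suc (n ℕ.∸ j ℕ.+ j ℕ.+ a ℕ.+ j)) ≈⟨ q^-cong (exponent-sum j a (n ℕ.∸ j)) ⟩
          q^ (suc j ℕ.* suc j ℕ.+ a ℕ.* suc j ℕ.+ (n ℕ.∸ j))         ≈⟨ q^-+ (suc j ℕ.* suc j ℕ.+ a ℕ.* suc j) _ ⟩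
          q^ (suc j ℕ.* suc j ℕ.+ a ℕ.* suc j) * q^ (n ℕ.∸ j)        ∎
        poch-L : poch (L ℕ.∸ j) ≈ poch (L ℕ.∸ suc j) * 1-q^ (suc (L ℕ.∸ suc j))
        poch-L = reflexive (≡.cong poch (ℕP.+-∸-assoc 1 (i≤l⇒i≤L 1+j≤l)))
        inv-a : inv (a ℕ.+ j) ≈ inv (a ℕ.+ suc j) * 1-q^ (a ℕ.+ suc j)
        inv-a = trans (sym (inv-suc (a ℕ.+ j))) (reflexive (≡.cong (λ k → inv k * 1-q^ k) (≡.sym (ℕP.+-suc a j))))

      module AtIndex (i : ℕ) (i≤l : i ≤ l) (i≤m : i ≤ m) (i≤1+n : i ≤ suc n) where
        l′ m′ n′ : ℕ
        l′ = l ℕ.∸ i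
        m′ = m ℕ.∸ i
        n′ = suc n ℕ.∸ i

        X A Lq Mq Nq : Carrier
        X  = q^ i
        A  = q^ a
        Lq = q^ l′
        Mq = q^ m′
        Nq = q^ n′

        l≡ : l ≡ l′ ℕ.+ i
        l≡ = ≡.sym (ℕP.m∸n+n≡m i≤l)
        m≡ : m ≡ m′ ℕ.+ i
        m≡ = ≡.sym (ℕP.m∸n+n≡m i≤m)
        1+n≡ : suc n ≡ n′ ℕ.+ i
        1+n≡ = ≡.sym (ℕP.m∸n+n≡m i≤1+n)

        q^-+₄ : ∀ x y z u → q^ (x ℕ.+ y ℕ.+ z ℕ.+ u) ≈ q^ x * q^ y * q^ z * q^ u
        q^-+₄ x y z u = trans (q^-+ (x ℕ.+ y ℕ.+ z) u) (*-congʳ (trans (q^-+ (x ℕ.+ y) z) (*-congʳ (q^-+ x y))))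

        q^-+₅ : ∀ x y z u v → q^ (x ℕ.+ y ℕ.+ z ℕ.+ u ℕ.+ v) ≈ q^ x * q^ y * q^ z * q^ u * q^ v
        q^-+₅ x y z u v = trans (q^-+ (x ℕ.+ y ℕ.+ z ℕ.+ u) v) (*-congʳ (q^-+₄ x y z u))

        q^[1+n] : q^ (suc n) ≈ Nq * X
        q^[1+n] = trans (q^-cong 1+n≡) (q^-+ n′ i)

        q^[1+n+a] : q^ (suc (n ℕ.+ a)) ≈ Nq * X * A
        q^[1+n+a] = trans (q^-cong (≡.cong (ℕ._+ a) 1+n≡)) (trans (q^-+ (n′ ℕ.+ i) a) (*-congʳ (q^-+ n′ i)))

        q^[1+x+n+a] : ∀ x x′ → x ≡ x′ ℕ.+ i → q^ (suc (x ℕ.+ n ℕ.+ a)) ≈ q^ x′ * Nq * A * X * X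
        q^[1+x+n+a] x x′ x≡ = trans (q^-cong exponent) (q^-+₅ x′ n′ a i i)
          where
          shuffle : ∀ x′ n′ a i → x′ ℕ.+ i ℕ.+ (n′ ℕ.+ i) ℕ.+ a ≡ x′ ℕ.+ n′ ℕ.+ a ℕ.+ i ℕ.+ i
          shuffle = ℕSolver.solve-∀
          exponent : suc (x ℕ.+ n ℕ.+ a) ≡ x′ ℕ.+ n′ ℕ.+ a ℕ.+ i ℕ.+ i
          exponent = ≡.trans (≡.cong (ℕ._+ a) (≡.sym (ℕP.+-suc x n)))
                     (≡.trans (≡.cong₂ (λ y z → y ℕ.+ z ℕ.+ a) x≡ 1+n≡) (shuffle x′ n′ a i))

        q^[1+L-i] : q^ (suc (L ℕ.∸ i)) ≈ Lq * Mq * Nq * A * X * X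
        q^[1+L-i] = trans (q^-cong exponent) (trans (q^-+ (l′ ℕ.+ m′ ℕ.+ n′ ℕ.+ a ℕ.+ i) i) (*-congʳ (q^-+₅ l′ m′ n′ a i)))
          where
          shuffle : ∀ l′ m′ n′ a i → l′ ℕ.+ i ℕ.+ (m′ ℕ.+ i) ℕ.+ (n′ ℕ.+ i) ℕ.+ a ≡ l′ ℕ.+ m′ ℕ.+ n′ ℕ.+ a ℕ.+ i ℕ.+ i ℕ.+ i
          shuffle = ℕSolver.solve-∀
          1+L≡ : suc L ≡ l′ ℕ.+ i ℕ.+ (m′ ℕ.+ i) ℕ.+ (n′ ℕ.+ i) ℕ.+ a
          1+L≡ = ≡.trans (≡.cong (ℕ._+ a) (≡.sym (ℕP.+-suc (l ℕ.+ m) n)))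
                 (≡.cong₂ (λ x y → x ℕ.+ y ℕ.+ a) (≡.cong₂ ℕ._+_ l≡ m≡) 1+n≡)
          exponent : suc (L ℕ.∸ i) ≡ l′ ℕ.+ m′ ℕ.+ n′ ℕ.+ a ℕ.+ i ℕ.+ i
          exponent = ℕP.+-cancelʳ-≡ i _ _
            (≡.trans (≡.cong suc (ℕP.m∸n+n≡m (i≤l⇒i≤L i≤l))) (≡.trans 1+L≡ (shuffle l′ m′ n′ a i)))

        q^[1+n+a+i] : q^ (suc (n ℕ.+ a ℕ.+ i)) ≈ Nq * A * X * X
        q^[1+n+a+i] = trans (q^-cong (≡.trans (≡.cong (λ x → x ℕ.+ a ℕ.+ i) 1+n≡) (shuffle n′ a i))) (q^-+₄ n′ a i i)
          where
          shuffle : ∀ n′ a i → n′ ℕ.+ i ℕ.+ a ℕ.+ i ≡ n′ ℕ.+ a ℕ.+ i ℕ.+ i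
          shuffle = ℕSolver.solve-∀

        W : Carrier
        W = weight i

        term-suc-as-weight : saalschützTerm a l m (suc n) i ≈ W * 1-q^ (suc (L ℕ.∸ i))
        term-suc-as-weight = begin
          saalschützTerm a l m (suc n) i
            ≡⟨ ≡.cong (λ k → q^ (i ℕ.* i ℕ.+ a ℕ.* i) * poch k * inv i * inv (a ℕ.+ i) * inv⊖ l i * inv⊖ m i * inv⊖ (suc n) i)
                      (≡.trans (≡.cong (λ k → k ℕ.+ a ℕ.∸ i) (ℕP.+-suc (l ℕ.+ m) n)) (ℕP.+-∸-assoc 1 (i≤l⇒i≤L i≤l))) ⟩
          q^ (i ℕ.* i ℕ.+ a ℕ.* i) * (poch (L ℕ.∸ i) * 1-q^ (suc (L ℕ.∸ i))) * inv i * inv (a ℕ.+ i)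
            * inv⊖ l i * inv⊖ m i * inv⊖ (suc n) i
            ≈⟨ solve 8 (λ e p d x₃ x₄ x₅ x₆ x₇ → e :* (p :* d) :* x₃ :* x₄ :* x₅ :* x₆ :* x₇
                                              := e :* p :* x₃ :* x₄ :* x₅ :* x₆ :* x₇ :* d) refl _ _ _ _ _ _ _ _ ⟩
          W * 1-q^ (suc (L ℕ.∸ i)) ∎

        term-as-weight : saalschützTerm a l m n i ≈ W * 1-q^ n′
        term-as-weight = trans (*-congˡ (inv⊖-sucˡ n i))
          (solve 8 (λ e p x₃ x₄ x₅ x₆ x₇ d → e :* p :* x₃ :* x₄ :* x₅ :* x₆ :* (x₇ :* d)
                                           := e :* p :* x₃ :* x₄ :* x₅ :* x₆ :* x₇ :* d) refl _ _ _ _ _ _ _ _)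

        certificate-as-weight : certificate i ≈ - (q^ (suc (n ℕ.+ a ℕ.+ i)) * (W * (1-q^ l′ * 1-q^ m′ * 1-q^ n′)))
        certificate-as-weight = -‿cong (trans
          (*-cong (*-cong (*-congˡ (inv⊖-sucʳ l i)) (inv⊖-sucʳ m i)) (inv⊖-sucˡ n i))
          (solve 11 (λ e e′ p x₃ x₄ x₅ dl x₆ dm x₇ dn →
                       e :* e′ :* p :* x₃ :* x₄ :* (x₅ :* dl) :* (x₆ :* dm) :* (x₇ :* dn)
                       := e′ :* (e :* p :* x₃ :* x₄ :* x₅ :* x₆ :* x₇ :* (dl :* dm :* dn))) refl _ _ _ _ _ _ _ _ _ _ _))

        telescopes : difference i ≈ certificate i - previous certificate i
        telescopes = begin
          difference i
            ≈⟨ +-cong (*-cong (*-cong (complement-cong q^[1+n]) (complement-cong q^[1+n+a])) (trans term-suc-as-weight (*-congˡ (complement-cong q^[1+L-i]))))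
                      (-‿cong (*-cong (*-cong (complement-cong (q^[1+x+n+a] m m′ m≡)) (complement-cong (q^[1+x+n+a] l l′ l≡))) term-as-weight)) ⟩
          (1# - Nq * X) * (1# - Nq * X * A) * (W * (1# - Lq * Mq * Nq * A * X * X))
            - (1# - Mq * Nq * A * X * X) * (1# - Lq * Nq * A * X * X) * (W * (1# - Nq))
            ≈⟨ wz-identity W X A Lq Mq Nq ⟩
          - (Nq * A * X * X * (W * ((1# - Lq) * (1# - Mq) * (1# - Nq))))
            - - (Nq * (W * ((1# - X) * (1# - A * X) * (1# - Lq * Mq * Nq * A * X * X))))
            ≈⟨ +-cong (sym (trans certificate-as-weight (-‿cong (*-congʳ q^[1+n+a+i]))))
                      (-‿cong (sym (trans (previous-certificate i i≤l i≤1+n)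
                        (-‿cong (*-congˡ (*-congˡ (*-cong (*-congˡ (complement-cong (q^-+ a i))) (complement-cong q^[1+L-i])))))))) ⟩
          certificate i - previous certificate i ∎

      difference-telescopes : ∀ i → i ≤ suc n → difference i ≈ certificate i - previous certificate i
      difference-telescopes i i≤1+n with l ℕP.<? i | m ℕP.<? i
      ... | yes l<i | _       = telescopes-beyond-l i l<i
      ... | no  l≮i | yes m<i = telescopes-beyond-m i m<i
      ... | no  l≮i | no  m≮i = AtIndex.telescopes i (ℕP.≮⇒≥ l≮i) (ℕP.≮⇒≥ m≮i) i≤1+n

      sum-recurrence : c₁ * sumℕ (suc n) (saalschützTerm a l m (suc n)) ≈ c₂ * sumℕ n (saalschützTerm a l m n)
      sum-recurrence = begin
        S₁                                  ≈⟨ +-identityʳ _ ⟨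
        S₁ + 0#                             ≈⟨ +-congˡ (-‿inverseˡ S₀) ⟨
        S₁ + (- S₀ + S₀)                    ≈⟨ +-assoc _ _ _ ⟨
        S₁ - S₀ + S₀                        ≈⟨ +-congʳ S₁-S₀≈0 ⟩
        0# + S₀                             ≈⟨ +-identityˡ _ ⟩
        S₀                                  ∎
        where
        S₁ S₀ : Carrier
        S₁ = c₁ * sumℕ (suc n) (saalschützTerm a l m (suc n))
        S₀ = c₂ * sumℕ n (saalschützTerm a l m n)
        last-term≈0 : saalschützTerm a l m n (suc n) ≈ 0#
        last-term≈0 = annihilateʳ (inv⊖-> n (suc n) ℕP.≤-refl)
        S₁-S₀≈0 : S₁ - S₀ ≈ 0#
        S₁-S₀≈0 = begin
          S₁ - S₀                                                    ≈⟨ +-congˡ (-‿cong (*-congˡ (trans (+-congˡ last-term≈0) (+-identityʳ _)))) ⟨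
          S₁ - c₂ * sumℕ (suc n) (saalschützTerm a l m n)            ≈⟨ sumℕ-linear (suc n) c₁ c₂ _ _ ⟨
          sumℕ (suc n) difference                                    ≈⟨ sumℕ-telescope (suc n) difference certificate difference-telescopes ⟩
          certificate (suc n)                                        ≈⟨ trans (-‿cong (annihilateʳ (inv⊖-> n (suc n) ℕP.≤-refl))) -0#≈0# ⟩
          0#                                                         ∎

      product-recurrence : c₁ * saalschützProduct a l m (suc n) ≈ c₂ * saalschützProduct a l m n
      product-recurrence = begin
        c₁ * saalschützProduct a l m (suc n)
          ≡⟨ ≡.cong₂ (λ x y → c₁ * (poch (l ℕ.+ m ℕ.+ a) * poch x * poch y * inv l * inv (l ℕ.+ a) * inv m * inv (m ℕ.+ a)
                                    * inv (suc n) * inv (suc n ℕ.+ a)))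
                     (x+[1+n]+a≡ m) (x+[1+n]+a≡ l) ⟩
        c₁ * (poch (l ℕ.+ m ℕ.+ a) * (poch (m ℕ.+ n ℕ.+ a) * 1-q^ (suc (m ℕ.+ n ℕ.+ a)))
              * (poch (l ℕ.+ n ℕ.+ a) * 1-q^ (suc (l ℕ.+ n ℕ.+ a)))
              * inv l * inv (l ℕ.+ a) * inv m * inv (m ℕ.+ a) * inv (suc n) * inv (suc (n ℕ.+ a)))
          ≈⟨ solve 13 (λ d₁ d₂ p₀ pm dm pl dl x₁ x₂ x₃ x₄ y₁ y₂ →
                 d₁ :* d₂ :* (p₀ :* (pm :* dm) :* (pl :* dl) :* x₁ :* x₂ :* x₃ :* x₄ :* y₁ :* y₂)
                 := dm :* dl :* (p₀ :* pm :* pl :* x₁ :* x₂ :* x₃ :* x₄ :* (y₁ :* d₁) :* (y₂ :* d₂)))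
               refl _ _ _ _ _ _ _ _ _ _ _ _ _ ⟩
        c₂ * (poch (l ℕ.+ m ℕ.+ a) * poch (m ℕ.+ n ℕ.+ a) * poch (l ℕ.+ n ℕ.+ a) * inv l * inv (l ℕ.+ a) * inv m * inv (m ℕ.+ a)
              * (inv (suc n) * 1-q^ (suc n)) * (inv (suc (n ℕ.+ a)) * 1-q^ (suc (n ℕ.+ a))))
          ≈⟨ *-congˡ (*-cong (*-congˡ (inv-suc n)) (inv-suc (n ℕ.+ a))) ⟩
        c₂ * saalschützProduct a l m n ∎
        where
        x+[1+n]+a≡ : ∀ x → x ℕ.+ suc n ℕ.+ a ≡ suc (x ℕ.+ n ℕ.+ a)
        x+[1+n]+a≡ x = ≡.cong (ℕ._+ a) (ℕP.+-suc x n)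

    qSaalschütz : ∀ a l m n → sumℕ n (saalschützTerm a l m n) ≈ saalschützProduct a l m n
    qSaalschütz a l m zero    = begin
      saalschützTerm a l m 0 0
        ≡⟨ ≡.cong₂ (λ x y → q^ x * poch y * inv 0 * inv (a ℕ.+ 0) * inv l * inv m * inv 0)
                   (ℕP.*-zeroʳ a) (≡.cong (ℕ._+ a) (ℕP.+-identityʳ (l ℕ.+ m))) ⟩
      1# * poch (l ℕ.+ m ℕ.+ a) * inv 0 * inv (a ℕ.+ 0) * inv l * inv m * inv 0
        ≡⟨ ≡.cong (λ x → 1# * poch (l ℕ.+ m ℕ.+ a) * inv 0 * inv x * inv l * inv m * inv 0) (ℕP.+-identityʳ a) ⟩
      1# * poch (l ℕ.+ m ℕ.+ a) * inv 0 * inv a * inv l * inv m * inv 0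
        ≈⟨ solve 5 (λ P I₀ Iₐ Iₗ Iₘ → con (+ 1) :* P :* I₀ :* Iₐ :* Iₗ :* Iₘ :* I₀ := P :* Iₗ :* Iₘ :* Iₐ :* (I₀ :* I₀)) refl _ _ _ _ _ ⟩
      core * (inv 0 * inv 0)
        ≈⟨ *-congˡ (trans (*-cong inv-0 inv-0) (*-identityˡ 1#)) ⟩
      core * 1#
        ≈⟨ *-congˡ (trans (*-cong (*-congʳ inv-0) (poch-inv (l ℕ.+ a))) (trans (*-identityʳ _) (trans (*-identityˡ _) (poch-inv (m ℕ.+ a))))) ⟨
      core * (inv 0 * (poch (m ℕ.+ a) * inv (m ℕ.+ a)) * (poch (l ℕ.+ a) * inv (l ℕ.+ a)))
        ≈⟨ solve 9 (λ P Iₗ Iₘ Iₐ I₀ Pₘ Iₘₐ Pₗ Iₗₐ → P :* Iₗ :* Iₘ :* Iₐ :* (I₀ :* (Pₘ :* Iₘₐ) :* (Pₗ :* Iₗₐ))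
                                                 := P :* Pₘ :* Pₗ :* Iₗ :* Iₗₐ :* Iₘ :* Iₘₐ :* I₀ :* Iₐ) refl _ _ _ _ _ _ _ _ _ ⟩
      poch (l ℕ.+ m ℕ.+ a) * poch (m ℕ.+ a) * poch (l ℕ.+ a) * inv l * inv (l ℕ.+ a) * inv m * inv (m ℕ.+ a) * inv 0 * inv a
        ≡⟨ ≡.cong₂ (λ x y → poch (l ℕ.+ m ℕ.+ a) * poch (x ℕ.+ a) * poch (y ℕ.+ a) * inv l * inv (l ℕ.+ a) * inv m
                             * inv (m ℕ.+ a) * inv 0 * inv a)
                   (≡.sym (ℕP.+-identityʳ m)) (≡.sym (ℕP.+-identityʳ l)) ⟩
      saalschützProduct a l m 0 ∎
      where
      core : Carrier
      core = poch (l ℕ.+ m ℕ.+ a) * inv l * inv m * inv a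
    qSaalschütz a l m (suc n) = 1-q^-cancelˡ (n ℕ.+ a) (1-q^-cancelˡ n (begin
      1-q^ (suc n) * (1-q^ (suc (n ℕ.+ a)) * sumℕ (suc n) (saalschützTerm a l m (suc n))) ≈⟨ *-assoc _ _ _ ⟨
      c₁ * sumℕ (suc n) (saalschützTerm a l m (suc n))   ≈⟨ sum-recurrence ⟩
      c₂ * sumℕ n (saalschützTerm a l m n)               ≈⟨ *-congˡ (qSaalschütz a l m n) ⟩
      c₂ * saalschützProduct a l m n                      ≈⟨ product-recurrence ⟨
      c₁ * saalschützProduct a l m (suc n)                ≈⟨ *-assoc _ _ _ ⟩
      1-q^ (suc n) * (1-q^ (suc (n ℕ.+ a)) * saalschützProduct a l m (suc n)) ∎))
      where open SaalschützRecurrence a l m n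

    vandermondeTerm-step : ∀ a c e s →
      1-q^ (suc a) * vandermondeTerm (suc a) c e s ≈ vandermondeCarry c a e s + q^ c * vandermondeTerm a c e s
    vandermondeTerm-step a c e zero = begin
      1-q^ (suc a) * (q^ (c ℕ.+ a ℕ.* c) * inv (suc a) * inv c * inv 0 * inv e)
        ≈⟨ *-congˡ (*-congʳ (*-congʳ (*-congʳ (*-congʳ (q^-+ c (a ℕ.* c)))))) ⟩
      1-q^ (suc a) * (q^ c * q^ (a ℕ.* c) * inv (suc a) * inv c * inv 0 * inv e)
        ≈⟨ solve 7 (λ d p₁ p₂ i₁ i₂ i₃ i₄ → d :* (p₁ :* p₂ :* i₁ :* i₂ :* i₃ :* i₄) := p₁ :* (p₂ :* (i₁ :* d) :* i₂ :* i₃ :* i₄))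
                 refl _ _ _ _ _ _ _ ⟩
      q^ c * (q^ (a ℕ.* c) * (inv (suc a) * 1-q^ (suc a)) * inv c * inv 0 * inv e)
        ≈⟨ *-congˡ (*-congʳ (*-congʳ (*-congʳ (*-congˡ (inv-suc a))))) ⟩
      q^ c * vandermondeTerm a c e 0
        ≈⟨ +-identityˡ _ ⟨
      0# + q^ c * vandermondeTerm a c e 0 ∎
    vandermondeTerm-step a zero e (suc s) = both-vanish
      (vandermondeTerm-≈0ᶜ (suc a) 0 e (suc s) refl) refl (vandermondeTerm-≈0ᶜ a 0 e (suc s) refl)
    vandermondeTerm-step a (suc c) e (suc s) with c ℕP.<? s | ℕP.<-cmp a s
    ... | yes c<s | _ = both-vanish (vandermondeTerm-≈0ᶜ (suc a) (suc c) e (suc s) (inv⊖-> c s c<s))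
      (vandermondeTerm-≈0ᶜ a c (suc e) s (inv⊖-> c s c<s)) (vandermondeTerm-≈0ᶜ a (suc c) e (suc s) (inv⊖-> c s c<s))
    ... | no _ | tri< a<s _ _ = both-vanish (vandermondeTerm-≈0ᵃ (suc a) (suc c) e (suc s) (inv⊖-> a s a<s))
      (vandermondeTerm-≈0ᵃ a c (suc e) s (inv⊖-> a s a<s))
      (vandermondeTerm-≈0ᵃ a (suc c) e (suc s) (inv⊖-> a (suc s) (ℕP.m<n⇒m<1+n a<s)))
    ... | no _ | tri≈ _ ≡.refl _ = begin
      1-q^ (suc a) * vandermondeTerm (suc a) (suc c) e (suc a)
        ≈⟨ solve 6 (λ d E D C I₁ Iₑ → d :* (E :* D :* C :* I₁ :* Iₑ) := E :* D :* C :* (I₁ :* d) :* Iₑ) refl _ _ _ _ _ _ ⟩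
      q^ ((a ℕ.∸ a) ℕ.* (c ℕ.∸ a)) * inv⊖ a a * inv⊖ c a * (inv (suc a) * 1-q^ (suc a)) * inv (suc a ℕ.+ e)
        ≈⟨ *-cong (*-congˡ (inv-suc a)) (reflexive (≡.cong inv (≡.sym (ℕP.+-suc a e)))) ⟩
      vandermondeTerm a c (suc e) a
        ≈⟨ +-identityʳ _ ⟨
      vandermondeTerm a c (suc e) a + 0#
        ≈⟨ +-congˡ (annihilateʳ (vandermondeTerm-≈0ᵃ a (suc c) e (suc a) (inv⊖-> a (suc a) ℕP.≤-refl))) ⟨
      vandermondeCarry (suc c) a e (suc a) + q^ (suc c) * vandermondeTerm a (suc c) e (suc a) ∎
    ... | no c≮s | tri> _ _ s<a = begin
      1-q^ (suc a) * (E * inv⊖ a s * inv⊖ c s * inv (suc s) * inv (suc s ℕ.+ e))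
        ≈⟨ *-congʳ (complement-cong q^[1+a]) ⟩
      (1# - x * y) * (E * inv⊖ a s * inv⊖ c s * inv (suc s) * inv (suc s ℕ.+ e))
        ≈⟨ solve 7 (λ x y E D C I₁ Iₑ → (con (+ 1) :- x :* y) :* (E :* D :* C :* I₁ :* Iₑ)
                     := E :* D :* C :* (I₁ :* (con (+ 1) :- x)) :* Iₑ :+ (E :* x) :* (D :* (con (+ 1) :- y)) :* C :* I₁ :* Iₑ)
                   refl x y E _ _ _ _ ⟩
      E * inv⊖ a s * inv⊖ c s * (inv (suc s) * 1-q^ (suc s)) * inv (suc s ℕ.+ e)
        + (E * x) * (inv⊖ a s * 1-q^ (a ℕ.∸ s)) * inv⊖ c s * inv (suc s) * inv (suc s ℕ.+ e)
        ≈⟨ +-cong (*-cong (*-congˡ (inv-suc s)) (reflexive (≡.cong inv (≡.sym (ℕP.+-suc s e)))))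
                  (*-congʳ (*-congʳ (*-congʳ (*-cong E*x≈ (sym (inv⊖-sucʳ a s)))))) ⟩
      vandermondeTerm a c (suc e) s + q^ (suc c) * E′ * inv⊖ a (suc s) * inv⊖ c s * inv (suc s) * inv (suc s ℕ.+ e)
        ≈⟨ +-congˡ (solve 6 (λ p E D C I₁ Iₑ → p :* E :* D :* C :* I₁ :* Iₑ := p :* (E :* D :* C :* I₁ :* Iₑ)) refl _ _ _ _ _ _) ⟩
      vandermondeCarry (suc c) a e (suc s) + q^ (suc c) * vandermondeTerm a (suc c) e (suc s) ∎
      where
      E E′ x y : Carrier
      E  = q^ ((a ℕ.∸ s) ℕ.* (c ℕ.∸ s))
      E′ = q^ ((a ℕ.∸ suc s) ℕ.* (c ℕ.∸ s))
      x  = q^ (suc s)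
      y  = q^ (a ℕ.∸ s)
      q^[1+a] : q^ (suc a) ≈ x * y
      q^[1+a] = trans (q^-cong (≡.sym (≡.cong suc (ℕP.m+[n∸m]≡n (ℕP.<⇒≤ s<a))))) (q^-+ (suc s) (a ℕ.∸ s))
      k j : ℕ
      k = a ℕ.∸ suc s
      j = c ℕ.∸ s
      exponent-shuffle : ∀ k j s → suc k ℕ.* j ℕ.+ suc s ≡ suc (s ℕ.+ j) ℕ.+ k ℕ.* j
      exponent-shuffle = ℕSolver.solve-∀
      exponent : (a ℕ.∸ s) ℕ.* (c ℕ.∸ s) ℕ.+ suc s ≡ suc c ℕ.+ (a ℕ.∸ suc s) ℕ.* (c ℕ.∸ s)
      exponent = ≡.trans (≡.cong (λ z → z ℕ.* j ℕ.+ suc s) (ℕP.+-∸-assoc 1 s<a))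
                 (≡.trans (exponent-shuffle k j s) (≡.cong (λ z → suc z ℕ.+ k ℕ.* j) (ℕP.m+[n∸m]≡n (ℕP.≮⇒≥ c≮s))))
      E*x≈ : E * x ≈ q^ (suc c) * E′
      E*x≈ = trans (sym (q^-+ ((a ℕ.∸ s) ℕ.* (c ℕ.∸ s)) (suc s))) (trans (q^-cong exponent) (q^-+ (suc c) _))

    vandermondeProduct-step₀ : ∀ a e → q^ 0 * vandermondeProduct a 0 e ≈ 1-q^ (suc a) * vandermondeProduct (suc a) 0 e
    vandermondeProduct-step₀ a e = begin
      1# * (inv a * inv (a ℕ.+ e) * inv 0 * inv e * poch (a ℕ.+ 0 ℕ.+ e))
        ≡⟨ ≡.cong (λ z → 1# * (inv a * inv (a ℕ.+ e) * inv 0 * inv e * poch (z ℕ.+ e))) (ℕP.+-identityʳ a) ⟩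
      1# * (inv a * inv (a ℕ.+ e) * inv 0 * inv e * poch (a ℕ.+ e))
        ≈⟨ solve 5 (λ iₐ iₐₑ i₀ iₑ p → con (+ 1) :* (iₐ :* iₐₑ :* i₀ :* iₑ :* p) := iₐ :* i₀ :* iₑ :* (iₐₑ :* p)) refl _ _ _ _ _ ⟩
      inv a * inv 0 * inv e * (inv (a ℕ.+ e) * poch (a ℕ.+ e))
        ≈⟨ *-congˡ (trans (inv-poch _) (sym (inv-poch (suc (a ℕ.+ e))))) ⟩
      inv a * inv 0 * inv e * (inv (suc (a ℕ.+ e)) * poch (suc (a ℕ.+ e)))
        ≈⟨ *-congʳ (*-congʳ (*-congʳ (inv-suc a))) ⟨
      inv (suc a) * 1-q^ (suc a) * inv 0 * inv e * (inv (suc (a ℕ.+ e)) * poch (suc (a ℕ.+ e)))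
        ≈⟨ solve 6 (λ i₁ d i₀ iₑ iₐₑ p → i₁ :* d :* i₀ :* iₑ :* (iₐₑ :* p) := d :* (i₁ :* iₐₑ :* i₀ :* iₑ :* p)) refl _ _ _ _ _ _ ⟩
      1-q^ (suc a) * (inv (suc a) * inv (suc (a ℕ.+ e)) * inv 0 * inv e * poch (suc (a ℕ.+ e)))
        ≡⟨ ≡.cong (λ z → 1-q^ (suc a) * (inv (suc a) * inv (suc (a ℕ.+ e)) * inv 0 * inv e * poch (suc z ℕ.+ e)))
                  (≡.sym (ℕP.+-identityʳ a)) ⟩
      1-q^ (suc a) * vandermondeProduct (suc a) 0 e ∎

    vandermondeProduct-step : ∀ a c e →
      vandermondeProduct a c (suc e) + q^ (suc c) * vandermondeProduct a (suc c) e
        ≈ 1-q^ (suc a) * vandermondeProduct (suc a) (suc c) e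
    vandermondeProduct-step a c e = begin
      inv a * inv (a ℕ.+ suc e) * inv c * inv (c ℕ.+ suc e) * poch (a ℕ.+ c ℕ.+ suc e) + q^ c′ * Π
        ≡⟨ ≡.cong₂ (λ x y → inv a * inv x * inv c * inv (c ℕ.+ suc e) * poch y + q^ c′ * Π) (ℕP.+-suc a e) (a+c+[1+e]≡ a c e) ⟩
      inv a * inv (suc (a ℕ.+ e)) * inv c * inv (c ℕ.+ suc e) * poch (a ℕ.+ c′ ℕ.+ e) + q^ c′ * Π
        ≡⟨ ≡.cong (λ x → inv a * inv (suc (a ℕ.+ e)) * inv c * inv x * poch (a ℕ.+ c′ ℕ.+ e) + q^ c′ * Π) (ℕP.+-suc c e) ⟩
      inv a * inv (suc (a ℕ.+ e)) * inv c * inv (c′ ℕ.+ e) * poch (a ℕ.+ c′ ℕ.+ e) + q^ c′ * Π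
        ≈⟨ +-cong (*-congʳ (*-congʳ (*-congˡ (sym (inv-suc c)))))
                  (*-congˡ (*-congʳ (*-congʳ (*-congʳ (*-congˡ (sym (inv-suc (a ℕ.+ e)))))))) ⟩
      inv a * inv (suc (a ℕ.+ e)) * (inv c′ * 1-q^ c′) * inv (c′ ℕ.+ e) * poch (a ℕ.+ c′ ℕ.+ e)
        + q^ c′ * (inv a * (inv (suc (a ℕ.+ e)) * 1-q^ (suc (a ℕ.+ e))) * inv c′ * inv (c′ ℕ.+ e) * poch (a ℕ.+ c′ ℕ.+ e))
        ≈⟨ solve 7 (λ iₐ iₐₛ ic ice p x y → iₐ :* iₐₛ :* (ic :* (con (+ 1) :- x)) :* ice :* p :+ x :* (iₐ :* (iₐₛ :* (con (+ 1) :- y)) :* ic :* ice :* p)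
                                        := (con (+ 1) :- x :* y) :* (iₐ :* iₐₛ :* ic :* ice :* p))
                   refl _ _ _ _ _ (q^ c′) (q^ (suc (a ℕ.+ e))) ⟩
      (1# - q^ c′ * q^ (suc (a ℕ.+ e))) * (inv a * inv (suc (a ℕ.+ e)) * inv c′ * inv (c′ ℕ.+ e) * poch (a ℕ.+ c′ ℕ.+ e))
        ≈⟨ *-congʳ (complement-cong (trans (sym (q^-+ c′ (suc (a ℕ.+ e)))) (q^-cong (exponent a c e)))) ⟩
      1-q^ (suc (a ℕ.+ c′ ℕ.+ e)) * (inv a * inv (suc (a ℕ.+ e)) * inv c′ * inv (c′ ℕ.+ e) * poch (a ℕ.+ c′ ℕ.+ e))
        ≈⟨ solve 6 (λ D iₐ iₐₛ ic ice p → D :* (iₐ :* iₐₛ :* ic :* ice :* p) := iₐ :* iₐₛ :* ic :* ice :* (p :* D)) refl _ _ _ _ _ _ ⟩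
      inv a * inv (suc (a ℕ.+ e)) * inv c′ * inv (c′ ℕ.+ e) * poch (suc (a ℕ.+ c′ ℕ.+ e))
        ≈⟨ *-congʳ (*-congʳ (*-congʳ (*-congʳ (inv-suc a)))) ⟨
      inv (suc a) * 1-q^ (suc a) * inv (suc (a ℕ.+ e)) * inv c′ * inv (c′ ℕ.+ e) * poch (suc (a ℕ.+ c′ ℕ.+ e))
        ≈⟨ solve 6 (λ i₁ d iₐₛ ic ice p → i₁ :* d :* iₐₛ :* ic :* ice :* p := d :* (i₁ :* iₐₛ :* ic :* ice :* p)) refl _ _ _ _ _ _ ⟩
      1-q^ (suc a) * vandermondeProduct (suc a) (suc c) e ∎
      where
      c′ : ℕ
      c′ = suc c
      Π : Carrier
      Π = vandermondeProduct a c′ e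
      a+c+[1+e]≡ : ∀ a c e → a ℕ.+ c ℕ.+ suc e ≡ a ℕ.+ suc c ℕ.+ e
      a+c+[1+e]≡ = ℕSolver.solve-∀
      exponent : ∀ a c e → suc c ℕ.+ suc (a ℕ.+ e) ≡ suc (a ℕ.+ suc c ℕ.+ e)
      exponent = ℕSolver.solve-∀

    qChuVandermonde : ∀ a c e → sumℕ a (vandermondeTerm a c e) ≈ vandermondeProduct a c e
    qChuVandermonde zero    c e = begin
      1# * inv 0 * inv c * inv 0 * inv e
        ≈⟨ solve 3 (λ i₀ ic iₑ → con (+ 1) :* i₀ :* ic :* i₀ :* iₑ := i₀ :* iₑ :* ic :* i₀) refl _ _ _ ⟩
      inv 0 * inv e * inv c * inv 0
        ≈⟨ *-congˡ (trans inv-0 (sym (inv-poch (c ℕ.+ e)))) ⟩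
      inv 0 * inv e * inv c * (inv (c ℕ.+ e) * poch (c ℕ.+ e))
        ≈⟨ *-assoc _ _ _ ⟨
      vandermondeProduct 0 c e ∎
    qChuVandermonde (suc a) c e = 1-q^-cancelˡ a (begin
      1-q^ (suc a) * sumℕ (suc a) (vandermondeTerm (suc a) c e)
        ≈⟨ *-distribˡ-sumℕ (suc a) _ _ ⟩
      sumℕ (suc a) (λ s → 1-q^ (suc a) * vandermondeTerm (suc a) c e s)
        ≈⟨ sumℕ-cong (suc a) (λ s _ → vandermondeTerm-step a c e s) ⟩
      sumℕ (suc a) (λ s → vandermondeCarry c a e s + q^ c * vandermondeTerm a c e s)
        ≈⟨ sumℕ-+ (suc a) _ _ ⟩
      sumℕ (suc a) (vandermondeCarry c a e) + sumℕ (suc a) (λ s → q^ c * vandermondeTerm a c e s)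
        ≈⟨ +-cong (trans (sumℕ-head a _) (+-identityˡ _)) (sym (*-distribˡ-sumℕ (suc a) _ _)) ⟩
      sumℕ a (λ s → vandermondeCarry c a e (suc s)) + q^ c * (sumℕ a (vandermondeTerm a c e) + vandermondeTerm a c e (suc a))
        ≈⟨ +-congˡ (*-congˡ (trans (+-cong (qChuVandermonde a c e)
                                           (vandermondeTerm-≈0ᵃ a c e (suc a) (inv⊖-> a (suc a) ℕP.≤-refl)))
                                   (+-identityʳ _))) ⟩
      sumℕ a (λ s → vandermondeCarry c a e (suc s)) + q^ c * vandermondeProduct a c e
        ≈⟨ carry-sum c ⟩
      1-q^ (suc a) * vandermondeProduct (suc a) c e ∎)
      where
      carry-sum : ∀ c → sumℕ a (λ s → vandermondeCarry c a e (suc s)) + q^ c * vandermondeProduct a c e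
                        ≈ 1-q^ (suc a) * vandermondeProduct (suc a) c e
      carry-sum zero    = trans (+-congʳ (sumℕ-≈0 a (λ _ _ → refl))) (trans (+-identityˡ _) (vandermondeProduct-step₀ a e))
      carry-sum (suc c) = trans (+-congʳ (qChuVandermonde a c (suc e))) (vandermondeProduct-step a c e)

    binomialWeight-pascal : ∀ M t →
      1-q^ (suc M) * binomialWeight (suc M) (suc t) ≈ binomialWeight M t + q^ (suc t) * binomialWeight M (suc t)
    binomialWeight-pascal M t with ℕP.<-cmp M t
    ... | tri< M<t _ _ = both-vanish (annihilateʳ (inv⊖-> M t M<t)) (binomialWeight-> M t M<t)
                                     (binomialWeight-> M (suc t) (ℕP.m<n⇒m<1+n M<t))
    ... | tri≈ _ ≡.refl _ = begin
      1-q^ (suc M) * (inv (suc M) * inv⊖ M M)      ≈⟨ solve 3 (λ d i x → d :* (i :* x) := i :* d :* x) refl _ _ _ ⟩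
      inv (suc M) * 1-q^ (suc M) * inv⊖ M M        ≈⟨ *-congʳ (inv-suc M) ⟩
      binomialWeight M M                           ≈⟨ +-identityʳ _ ⟨
      binomialWeight M M + 0#                      ≈⟨ +-congˡ (annihilateʳ (binomialWeight-> M (suc M) ℕP.≤-refl)) ⟨
      binomialWeight M M + q^ (suc M) * binomialWeight M (suc M) ∎
    ... | tri> _ _ t<M = begin
      1-q^ (suc M) * (inv (suc t) * inv⊖ M t)
        ≈⟨ *-congʳ (complement-cong q^[1+M]) ⟩
      (1# - x * y) * (inv (suc t) * inv⊖ M t)
        ≈⟨ solve 4 (λ x y i D → (con (+ 1) :- x :* y) :* (i :* D)
                                := i :* (con (+ 1) :- x) :* D :+ x :* (i :* (D :* (con (+ 1) :- y)))) refl x y _ _ ⟩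
      inv (suc t) * 1-q^ (suc t) * inv⊖ M t + x * (inv (suc t) * (inv⊖ M t * 1-q^ (M ℕ.∸ t)))
        ≈⟨ +-cong (*-congʳ (inv-suc t)) (*-congˡ (*-congˡ (sym (inv⊖-sucʳ M t)))) ⟩
      binomialWeight M t + q^ (suc t) * binomialWeight M (suc t) ∎
      where
      x y : Carrier
      x = q^ (suc t)
      y = q^ (M ℕ.∸ t)
      q^[1+M] : q^ (suc M) ≈ x * y
      q^[1+M] = trans (q^-cong (≡.sym (≡.cong suc (ℕP.m+[n∸m]≡n (ℕP.<⇒≤ t<M))))) (q^-+ (suc t) (M ℕ.∸ t))

    sum-binomialWeight-pascal : ∀ M (a : ℕ → Carrier) →
      1-q^ (suc M) * sumℕ (suc M) (λ t → a t * binomialWeight (suc M) t)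
        ≈ sumℕ M (λ s → (a (suc s) + a s * q^ s) * binomialWeight M s)
    sum-binomialWeight-pascal M a = begin
      1-q^ (suc M) * sumℕ (suc M) (λ t → a t * binomialWeight (suc M) t)
        ≈⟨ trans (*-distribˡ-sumℕ (suc M) _ _) (sumℕ-head M _) ⟩
      1-q^ (suc M) * (a 0 * binomialWeight (suc M) 0) + sumℕ M (λ s → 1-q^ (suc M) * (a (suc s) * binomialWeight (suc M) (suc s)))
        ≈⟨ +-cong first-term (sumℕ-cong M (λ s _ → pascal-term s)) ⟩
      a 0 * q^ 0 * binomialWeight M 0 + sumℕ M (λ s → a (suc s) * binomialWeight M s + a (suc s) * q^ (suc s) * binomialWeight M (suc s))
        ≈⟨ +-congˡ (sumℕ-+ M _ _) ⟩
      a 0 * q^ 0 * binomialWeight M 0 + (sumℕ M (λ s → a (suc s) * binomialWeight M s) + sumℕ M (λ s → a (suc s) * q^ (suc s) * binomialWeight M (suc s)))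
        ≈⟨ solve 3 (λ x y z → x :+ (y :+ z) := y :+ (x :+ z)) refl _ _ _ ⟩
      sumℕ M (λ s → a (suc s) * binomialWeight M s) + (a 0 * q^ 0 * binomialWeight M 0 + sumℕ M (λ s → a (suc s) * q^ (suc s) * binomialWeight M (suc s)))
        ≈⟨ +-congˡ (sumℕ-unshift M (λ t → a t * q^ t * binomialWeight M t) (annihilateʳ (binomialWeight-> M (suc M) ℕP.≤-refl))) ⟩
      sumℕ M (λ s → a (suc s) * binomialWeight M s) + sumℕ M (λ s → a s * q^ s * binomialWeight M s)
        ≈⟨ sumℕ-+ M _ _ ⟨
      sumℕ M (λ s → a (suc s) * binomialWeight M s + a s * q^ s * binomialWeight M s)
        ≈⟨ sumℕ-cong M (λ s _ → sym (distribʳ _ _ _)) ⟩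
      sumℕ M (λ s → (a (suc s) + a s * q^ s) * binomialWeight M s) ∎
      where
      first-term : 1-q^ (suc M) * (a 0 * binomialWeight (suc M) 0) ≈ a 0 * q^ 0 * binomialWeight M 0
      first-term = begin
        1-q^ (suc M) * (a 0 * (inv 0 * inv (suc M)))       ≈⟨ solve 4 (λ d a i₀ i₁ → d :* (a :* (i₀ :* i₁)) := a :* con (+ 1) :* (i₀ :* (i₁ :* d))) refl _ _ _ _ ⟩
        a 0 * 1# * (inv 0 * (inv (suc M) * 1-q^ (suc M)))  ≈⟨ *-congˡ (*-congˡ (inv-suc M)) ⟩
        a 0 * q^ 0 * binomialWeight M 0                    ∎
      pascal-term : ∀ s → 1-q^ (suc M) * (a (suc s) * binomialWeight (suc M) (suc s))
                          ≈ a (suc s) * binomialWeight M s + a (suc s) * q^ (suc s) * binomialWeight M (suc s)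
      pascal-term s = begin
        1-q^ (suc M) * (a (suc s) * binomialWeight (suc M) (suc s))      ≈⟨ solve 3 (λ d a x → d :* (a :* x) := a :* (d :* x)) refl _ _ _ ⟩
        a (suc s) * (1-q^ (suc M) * binomialWeight (suc M) (suc s))      ≈⟨ *-congˡ (binomialWeight-pascal M s) ⟩
        a (suc s) * (binomialWeight M s + q^ (suc s) * binomialWeight M (suc s))
          ≈⟨ solve 4 (λ a w p v → a :* (w :+ p :* v) := a :* w :+ a :* p :* v) refl _ _ _ _ ⟩
        a (suc s) * binomialWeight M s + a (suc s) * q^ (suc s) * binomialWeight M (suc s) ∎

    -- By the q-binomial theorem the sum is a multiple of (q^{-r}; q)_M, which vanishes for r < M.
    alternatingSum-≈0 : ∀ M r → r < M → alternatingSum M r ≈ 0#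
    alternatingSum-≈0 (suc M) r r<1+M = 1-q^-cancelˡ M (begin
      1-q^ (suc M) * alternatingSum (suc M) r
        ≈⟨ sum-binomialWeight-pascal M (λ t → sign t * q^ (triangular⊖ t r)) ⟩
      sumℕ M (λ s → (sign (suc s) * q^ (triangular⊖ (suc s) r) + sign s * q^ (triangular⊖ s r) * q^ s) * binomialWeight M s)
        ≈⟨ recurrence r r<1+M ⟩
      0#
        ≈⟨ zeroʳ _ ⟨
      1-q^ (suc M) * 0# ∎)
      where
      recurrence : ∀ r → r < suc M →
        sumℕ M (λ s → (sign (suc s) * q^ (triangular⊖ (suc s) r) + sign s * q^ (triangular⊖ s r) * q^ s) * binomialWeight M s) ≈ 0#
      recurrence zero _ = sumℕ-≈0 M (λ s _ → annihilateˡ (begin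
        sign (suc s) * q^ (triangular s ℕ.+ s) + sign s * q^ (triangular s) * q^ s
          ≈⟨ +-congʳ (*-cong (sign-suc s) (q^-+ (triangular s) s)) ⟩
        - sign s * (q^ (triangular s) * q^ s) + sign s * q^ (triangular s) * q^ s
          ≈⟨ solve 3 (λ a b c → :- a :* (b :* c) :+ a :* b :* c := con (+ 0)) refl _ _ _ ⟩
        0# ∎))
      recurrence (suc r) (s≤s r<M) = begin
        sumℕ M (λ s → (sign (suc s) * q^ (triangular⊖ s r) + sign s * q^ (triangular⊖ s (suc r)) * q^ s) * binomialWeight M s)
          ≈⟨ sumℕ-cong M (λ s _ → *-congʳ (+-cong (*-congʳ (sign-suc s)) (trans (*-assoc _ _ _) (*-congˡ (exponent s))))) ⟩
        sumℕ M (λ s → (- sign s * q^ (triangular⊖ s r) + sign s * (q^ (triangular⊖ s r) * q^ (suc r))) * binomialWeight M s)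
          ≈⟨ sumℕ-cong M (λ s _ → solve 4 (λ a b c x → (:- a :* b :+ a :* (b :* c)) :* x := (c :- con (+ 1)) :* (a :* b :* x)) refl _ _ _ _) ⟩
        sumℕ M (λ s → (q^ (suc r) - 1#) * (sign s * q^ (triangular⊖ s r) * binomialWeight M s))
          ≈⟨ *-distribˡ-sumℕ M _ _ ⟨
        (q^ (suc r) - 1#) * alternatingSum M r
          ≈⟨ annihilateʳ (alternatingSum-≈0 M r r<M) ⟩
        0# ∎
        where
        exponent : ∀ s → q^ (triangular⊖ s (suc r)) * q^ s ≈ q^ (triangular⊖ s r) * q^ (suc r)
        exponent s = trans (sym (q^-+ (triangular⊖ s (suc r)) s))
                     (trans (q^-cong (triangular⊖-suc s r)) (q^-+ (triangular⊖ s r) (suc r)))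

    alternatingSum-central : ∀ e → e ≤ 1 → ∀ N → sign (N ℕ.+ e) * alternatingSum (N ℕ.+ N ℕ.+ e) (N ℕ.+ e) ≈ δ₀ N
    alternatingSum-central e _ (suc N) =
      annihilateʳ (alternatingSum-≈0 (suc N ℕ.+ suc N ℕ.+ e) (suc N ℕ.+ e) (ℕP.+-monoˡ-< e (ℕP.m<m+n (suc N) (s≤s z≤n))))
    alternatingSum-central zero    _ zero = trans (solve 1 (λ x → con (+ 1) :* (con (+ 1) :* con (+ 1) :* (x :* x)) := x :* x) refl _)
                                                 (trans (*-cong inv-0 inv-0) (*-identityˡ _))
    alternatingSum-central (suc zero) _ zero = begin
      - 1# * 1# * (1# * (q * 1#) * (inv 0 * inv 1) + - 1# * 1# * 1# * (inv 1 * inv 0))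
        ≈⟨ solve 3 (λ q x y → :- con (+ 1) :* con (+ 1) :* (con (+ 1) :* (q :* con (+ 1)) :* (x :* y)
                                :+ :- con (+ 1) :* con (+ 1) :* con (+ 1) :* (y :* x))
                              := x :* (y :* (con (+ 1) :- q :* con (+ 1)))) refl _ _ _ ⟩
      inv 0 * (inv 1 * 1-q^ 1)   ≈⟨ *-cong inv-0 (inv-suc 0) ⟩
      1# * inv 0                 ≈⟨ trans (*-identityˡ _) inv-0 ⟩
      1#                         ∎
    alternatingSum-central (suc (suc e)) (s≤s ()) zero

    unitBaileyPair : ∀ e → e ≤ 1 → ∀ W N → N ≤ W →
      sumℕ (W ℕ.+ W ℕ.+ e) (unitBaileySummand e (W ℕ.+ e) N) ≈ δ₀ N
    unitBaileyPair e e≤1 W N N≤W =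
      ≡.subst (λ W → sumℕ (W ℕ.+ W ℕ.+ e) (unitBaileySummand e (W ℕ.+ e) N) ≈ δ₀ N) (ℕP.m∸n+n≡m N≤W) (padded (W ℕ.∸ N))
      where
      length : ∀ p N e → p ℕ.+ N ℕ.+ (p ℕ.+ N) ℕ.+ e ≡ p ℕ.+ (N ℕ.+ N ℕ.+ e) ℕ.+ p
      length = ℕSolver.solve-∀
      padded : ∀ p → sumℕ (p ℕ.+ N ℕ.+ (p ℕ.+ N) ℕ.+ e) (unitBaileySummand e (p ℕ.+ N ℕ.+ e) N) ≈ δ₀ N
      padded p = begin
        sumℕ (p ℕ.+ N ℕ.+ (p ℕ.+ N) ℕ.+ e) (unitBaileySummand e (p ℕ.+ N ℕ.+ e) N)
          ≡⟨ ≡.cong₂ (λ x y → sumℕ x (unitBaileySummand e y N)) (length p N e) (ℕP.+-assoc p N e) ⟩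
        sumℕ (p ℕ.+ (N ℕ.+ N ℕ.+ e) ℕ.+ p) f
          ≈⟨ sumℕ-padʳ (p ℕ.+ (N ℕ.+ N ℕ.+ e)) p (unitBaileySummand-tail e p N) ⟩
        sumℕ (p ℕ.+ (N ℕ.+ N ℕ.+ e)) f
          ≈⟨ sumℕ-dropˡ p (N ℕ.+ N ℕ.+ e) f (unitBaileySummand-head e p N) ⟩
        sumℕ (N ℕ.+ N ℕ.+ e) (λ t → f (p ℕ.+ t))
          ≈⟨ sumℕ-cong (N ℕ.+ N ℕ.+ e) (λ t _ → unitBaileySummand-shift e p N t) ⟩
        sumℕ (N ℕ.+ N ℕ.+ e) (λ t → sign (N ℕ.+ e) * (sign t * q^ (triangular⊖ t (N ℕ.+ e)) * binomialWeight (N ℕ.+ N ℕ.+ e) t))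
          ≈⟨ *-distribˡ-sumℕ (N ℕ.+ N ℕ.+ e) _ _ ⟨
        sign (N ℕ.+ e) * alternatingSum (N ℕ.+ N ℕ.+ e) (N ℕ.+ e)
          ≈⟨ alternatingSum-central e e≤1 N ⟩
        δ₀ N ∎
        where
        f : ℕ → Carrier
        f = unitBaileySummand e (p ℕ.+ (N ℕ.+ e)) N

    baileyWeightℕ-product-aligned : ∀ e j a v →
      baileyWeightℕ e j (j ℕ.+ a) * baileyWeightℕ e j (j ℕ.+ v) * poch (j ℕ.+ a ℕ.+ (j ℕ.+ v) ℕ.+ e)
        ≈ sumℕ (j ℕ.+ a) (λ N → linearizationCoefficient (j ℕ.+ a) (j ℕ.+ v) N * baileyWeightℕ e j N)
    baileyWeightℕ-product-aligned e j a v = begin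
      baileyWeightℕ e j (j ℕ.+ a) * baileyWeightℕ e j (j ℕ.+ v) * poch (j ℕ.+ a ℕ.+ (j ℕ.+ v) ℕ.+ e)
        ≡⟨ ≡.cong₂ _*_ (≡.cong₂ _*_ (baileyWeightℕ-shift e j a) (baileyWeightℕ-shift e j v)) (≡.cong poch (shuffle j a v e)) ⟩
      inv a * inv (a ℕ.+ E) * (inv v * inv (v ℕ.+ E)) * poch (a ℕ.+ v ℕ.+ E)
        ≈⟨ *-congʳ (*-assoc _ _ _) ⟨
      vandermondeProduct a v E
        ≈⟨ qChuVandermonde a v E ⟨
      sumℕ a (vandermondeTerm a v E)
        ≈⟨ sumℕ-cong a (λ s s≤a → linearizationCoefficient-shift e j a v s s≤a) ⟨
      sumℕ a (λ s → linearizationCoefficient (j ℕ.+ a) (j ℕ.+ v) (j ℕ.+ s) * baileyWeightℕ e j (j ℕ.+ s))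
        ≈⟨ sumℕ-dropˡ j a _ (λ N N<j → annihilateʳ (baileyWeightℕ-> e j N N<j)) ⟨
      sumℕ (j ℕ.+ a) (λ N → linearizationCoefficient (j ℕ.+ a) (j ℕ.+ v) N * baileyWeightℕ e j N) ∎
      where
      E : ℕ
      E = j ℕ.+ j ℕ.+ e
      shuffle : ∀ j a v e → j ℕ.+ a ℕ.+ (j ℕ.+ v) ℕ.+ e ≡ a ℕ.+ v ℕ.+ (j ℕ.+ j ℕ.+ e)
      shuffle = ℕSolver.solve-∀

    -- This is q-Chu–Vandermonde after the substitution k = j + a, u = j + v, N = j + s.
    baileyWeightℕ-product : ∀ e j k u →
      baileyWeightℕ e j k * baileyWeightℕ e j u * poch (k ℕ.+ u ℕ.+ e)
        ≈ sumℕ k (λ N → linearizationCoefficient k u N * baileyWeightℕ e j N)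
    baileyWeightℕ-product e j k u with k ℕP.<? j | u ℕP.<? j
    ... | yes k<j | _ = trans (annihilateˡ (annihilateˡ (baileyWeightℕ-> e j k k<j)))
      (sym (sumℕ-≈0 k (λ N N≤k → annihilateʳ (baileyWeightℕ-> e j N (ℕP.≤-<-trans N≤k k<j)))))
    ... | no _ | yes u<j = trans (annihilateˡ (annihilateʳ (baileyWeightℕ-> e j u u<j))) (sym (sumℕ-≈0 k term≈0))
      where
      term≈0 : ∀ N → N ≤ k → linearizationCoefficient k u N * baileyWeightℕ e j N ≈ 0#
      term≈0 N _ with N ℕP.<? j
      ... | yes N<j = annihilateʳ (baileyWeightℕ-> e j N N<j)
      ... | no  N≮j = annihilateˡ (annihilateʳ (inv⊖-> u N (ℕP.<-≤-trans u<j (ℕP.≮⇒≥ N≮j))))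
    ... | no k≮j | no u≮j = aligned (k ℕ.∸ j) (u ℕ.∸ j) (ℕP.m+[n∸m]≡n (ℕP.≮⇒≥ k≮j)) (ℕP.m+[n∸m]≡n (ℕP.≮⇒≥ u≮j))
      where
      aligned : ∀ {k u} a v → j ℕ.+ a ≡ k → j ℕ.+ v ≡ u →
        baileyWeightℕ e j k * baileyWeightℕ e j u * poch (k ℕ.+ u ℕ.+ e)
          ≈ sumℕ k (λ N → linearizationCoefficient k u N * baileyWeightℕ e j N)
      aligned a v ≡.refl ≡.refl = baileyWeightℕ-product-aligned e j a v

    baileyWeight-product : ∀ e → e ≤ 1 → ∀ j k u →
      baileyWeight e j k * baileyWeight e j u * poch (k ℕ.+ u ℕ.+ e)
        ≈ sumℕ k (λ N → linearizationCoefficient k u N * baileyWeight e j N)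
    baileyWeight-product e e≤1 j k u = begin
      baileyWeight e j k * baileyWeight e j u * poch (k ℕ.+ u ℕ.+ e)
        ≈⟨ *-congʳ (*-cong (baileyWeight-fold e e≤1 j k) (baileyWeight-fold e e≤1 j u)) ⟩
      baileyWeightℕ e (foldIndex e j) k * baileyWeightℕ e (foldIndex e j) u * poch (k ℕ.+ u ℕ.+ e)
        ≈⟨ baileyWeightℕ-product e (foldIndex e j) k u ⟩
      sumℕ k (λ N → linearizationCoefficient k u N * baileyWeightℕ e (foldIndex e j) N)
        ≈⟨ sumℕ-cong k (λ N _ → *-congˡ (baileyWeight-fold e e≤1 j N)) ⟨
      sumℕ k (λ N → linearizationCoefficient k u N * baileyWeight e j N) ∎

    bilinearBaileySum : ∀ e → e ≤ 1 → ∀ W k u → k ≤ W →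
      sumℕ (W ℕ.+ W ℕ.+ e) (λ t → σ (t ℤ.⊖ (W ℕ.+ e)) * baileyWeight e (t ℤ.⊖ (W ℕ.+ e)) k * baileyWeight e (t ℤ.⊖ (W ℕ.+ e)) u)
        ≈ q^ (k ℕ.* u) * inv k * inv u * inv (k ℕ.+ u ℕ.+ e)
    bilinearBaileySum e e≤1 W k u k≤W = poch-cancelˡ Q (begin
      poch Q * sumℕ M (λ t → σ (J t) * A (J t) k * A (J t) u)
        ≈⟨ *-distribˡ-sumℕ M _ _ ⟩
      sumℕ M (λ t → poch Q * (σ (J t) * A (J t) k * A (J t) u))
        ≈⟨ sumℕ-cong M (λ t _ → trans (solve 4 (λ p s a b → p :* (s :* a :* b) := s :* (a :* b :* p)) refl _ _ _ _)
                                      (*-congˡ (baileyWeight-product e e≤1 (J t) k u))) ⟩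
      sumℕ M (λ t → σ (J t) * sumℕ k (λ N → γ N * A (J t) N))
        ≈⟨ sumℕ-cong M (λ t _ → trans (*-distribˡ-sumℕ k _ _) (sumℕ-cong k (λ N _ → solve 3 (λ s c a → s :* (c :* a) := c :* (s :* a)) refl _ _ _))) ⟩
      sumℕ M (λ t → sumℕ k (λ N → γ N * (σ (J t) * A (J t) N)))
        ≈⟨ sumℕ-swap M k _ ⟩
      sumℕ k (λ N → sumℕ M (λ t → γ N * (σ (J t) * A (J t) N)))
        ≈⟨ sumℕ-cong k (λ N N≤k → trans (sym (*-distribˡ-sumℕ M _ _)) (*-congˡ (unitBaileyPair e e≤1 W N (ℕP.≤-trans N≤k k≤W)))) ⟩
      sumℕ k (λ N → γ N * δ₀ N)
        ≈⟨ sumℕ-dropʳ 0 k z≤n (λ { (suc N) _ → zeroʳ _ }) ⟩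
      γ 0 * 1#
        ≈⟨ *-identityʳ _ ⟩
      q^ (k ℕ.* u) * inv k * inv u
        ≈⟨ *-identityʳ _ ⟨
      q^ (k ℕ.* u) * inv k * inv u * 1#
        ≈⟨ *-congˡ (poch-inv Q) ⟨
      q^ (k ℕ.* u) * inv k * inv u * (poch Q * inv Q)
        ≈⟨ solve 5 (λ x y z p w → x :* y :* z :* (p :* w) := p :* (x :* y :* z :* w)) refl _ _ _ _ _ ⟩
      poch Q * (q^ (k ℕ.* u) * inv k * inv u * inv Q) ∎)
      where
      Q M : ℕ
      Q = k ℕ.+ u ℕ.+ e
      M = W ℕ.+ W ℕ.+ e
      J : ℕ → ℤ
      J t = t ℤ.⊖ (W ℕ.+ e)
      A : ℤ → ℕ → Carrier
      A = baileyWeight e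
      γ : ℕ → Carrier
      γ = linearizationCoefficient k u

    saalschütz-baileyWeightℕ-aligned : ∀ e j l₀ m₀ n₀ →
      sumℕ (j ℕ.+ n₀) (λ k → saalschützCoefficient e (j ℕ.+ l₀) (j ℕ.+ m₀) (j ℕ.+ n₀) k * baileyWeightℕ e j k)
        ≈ q^ (j ℕ.* j ℕ.+ e ℕ.* j) * pochTriple e (j ℕ.+ l₀) (j ℕ.+ m₀) (j ℕ.+ n₀)
          * baileyWeightℕ e j (j ℕ.+ l₀) * baileyWeightℕ e j (j ℕ.+ m₀) * baileyWeightℕ e j (j ℕ.+ n₀)
    saalschütz-baileyWeightℕ-aligned e j l₀ m₀ n₀ = begin
      sumℕ (j ℕ.+ n₀) (λ k → saalschützCoefficient e (j ℕ.+ l₀) (j ℕ.+ m₀) (j ℕ.+ n₀) k * baileyWeightℕ e j k)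
        ≈⟨ sumℕ-dropˡ j n₀ _ (λ k k<j → annihilateʳ (baileyWeightℕ-> e j k k<j)) ⟩
      sumℕ n₀ (λ i → saalschützCoefficient e (j ℕ.+ l₀) (j ℕ.+ m₀) (j ℕ.+ n₀) (j ℕ.+ i) * baileyWeightℕ e j (j ℕ.+ i))
        ≈⟨ sumℕ-cong n₀ (λ i _ → saalschützCoefficient-shift e j l₀ m₀ n₀ i) ⟩
      sumℕ n₀ (λ i → q^ w * saalschützTerm (j ℕ.+ j ℕ.+ e) l₀ m₀ n₀ i)
        ≈⟨ *-distribˡ-sumℕ n₀ _ _ ⟨
      q^ w * sumℕ n₀ (saalschützTerm (j ℕ.+ j ℕ.+ e) l₀ m₀ n₀)
        ≈⟨ *-congˡ (trans (qSaalschütz (j ℕ.+ j ℕ.+ e) l₀ m₀ n₀) (saalschützProduct-shift e j l₀ m₀ n₀)) ⟩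
      q^ w * (pochTriple e (j ℕ.+ l₀) (j ℕ.+ m₀) (j ℕ.+ n₀) * Bₗ * Bₘ * Bₙ)
        ≈⟨ solve 5 (λ w p x y z → w :* (p :* x :* y :* z) := w :* p :* x :* y :* z) refl _ _ _ _ _ ⟩
      q^ w * pochTriple e (j ℕ.+ l₀) (j ℕ.+ m₀) (j ℕ.+ n₀) * Bₗ * Bₘ * Bₙ ∎
      where
      w : ℕ
      w = j ℕ.* j ℕ.+ e ℕ.* j
      Bₗ Bₘ Bₙ : Carrier
      Bₗ = baileyWeightℕ e j (j ℕ.+ l₀)
      Bₘ = baileyWeightℕ e j (j ℕ.+ m₀)
      Bₙ = baileyWeightℕ e j (j ℕ.+ n₀)

    saalschütz-baileyWeightℕ : ∀ e j l m n →
      sumℕ n (λ k → saalschützCoefficient e l m n k * baileyWeightℕ e j k)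
        ≈ q^ (j ℕ.* j ℕ.+ e ℕ.* j) * pochTriple e l m n * baileyWeightℕ e j l * baileyWeightℕ e j m * baileyWeightℕ e j n
    saalschütz-baileyWeightℕ e j l m n with l ℕP.<? j | m ℕP.<? j | n ℕP.<? j
    ... | yes l<j | _ | _ =
      trans (sumℕ-≈0 n (λ k _ → saalschützCoefficient*baileyWeightℕ-≈0 e j l m n k
                                  (λ k j≤k → annihilateˡ (annihilateˡ (annihilateʳ (inv⊖-> l k (ℕP.<-≤-trans l<j j≤k)))))))
            (sym (annihilateˡ (annihilateˡ (annihilateʳ (baileyWeightℕ-> e j l l<j)))))
    ... | no _ | yes m<j | _ =
      trans (sumℕ-≈0 n (λ k _ → saalschützCoefficient*baileyWeightℕ-≈0 e j l m n k
                                  (λ k j≤k → annihilateˡ (annihilateʳ (inv⊖-> m k (ℕP.<-≤-trans m<j j≤k))))))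
            (sym (annihilateˡ (annihilateʳ (baileyWeightℕ-> e j m m<j))))
    ... | no _ | no _ | yes n<j =
      trans (sumℕ-≈0 n (λ k _ → saalschützCoefficient*baileyWeightℕ-≈0 e j l m n k
                                  (λ k j≤k → annihilateʳ (inv⊖-> n k (ℕP.<-≤-trans n<j j≤k)))))
            (sym (annihilateʳ (baileyWeightℕ-> e j n n<j)))
    ... | no l≮j | no m≮j | no n≮j = aligned (l ℕ.∸ j) (m ℕ.∸ j) (n ℕ.∸ j)
      (ℕP.m+[n∸m]≡n (ℕP.≮⇒≥ l≮j)) (ℕP.m+[n∸m]≡n (ℕP.≮⇒≥ m≮j)) (ℕP.m+[n∸m]≡n (ℕP.≮⇒≥ n≮j))
      where
      aligned : ∀ {l m n} l₀ m₀ n₀ → j ℕ.+ l₀ ≡ l → j ℕ.+ m₀ ≡ m → j ℕ.+ n₀ ≡ n →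
        sumℕ n (λ k → saalschützCoefficient e l m n k * baileyWeightℕ e j k)
          ≈ q^ (j ℕ.* j ℕ.+ e ℕ.* j) * pochTriple e l m n * baileyWeightℕ e j l * baileyWeightℕ e j m * baileyWeightℕ e j n
      aligned l₀ m₀ n₀ ≡.refl ≡.refl ≡.refl = saalschütz-baileyWeightℕ-aligned e j l₀ m₀ n₀

    saalschütz-baileyWeight : ∀ e → e ≤ 1 → ∀ j l m n →
      sumℕ n (λ k → saalschützCoefficient e l m n k * baileyWeight e j k)
        ≈ q^ (foldExponent e j) * pochTriple e l m n * baileyWeight e j l * baileyWeight e j m * baileyWeight e j n
    saalschütz-baileyWeight e e≤1 j l m n = begin
      sumℕ n (λ k → saalschützCoefficient e l m n k * baileyWeight e j k)
        ≈⟨ sumℕ-cong n (λ k _ → *-congˡ (fold k)) ⟩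
      sumℕ n (λ k → saalschützCoefficient e l m n k * baileyWeightℕ e (foldIndex e j) k)
        ≈⟨ saalschütz-baileyWeightℕ e (foldIndex e j) l m n ⟩
      q^ (foldExponent e j) * pochTriple e l m n * baileyWeightℕ e (foldIndex e j) l
        * baileyWeightℕ e (foldIndex e j) m * baileyWeightℕ e (foldIndex e j) n
        ≈⟨ *-cong (*-cong (*-congˡ (fold l)) (fold m)) (fold n) ⟨
      q^ (foldExponent e j) * pochTriple e l m n * baileyWeight e j l * baileyWeight e j m * baileyWeight e j n ∎
      where
      fold : ∀ x → baileyWeight e j x ≈ baileyWeightℕ e (foldIndex e j) x
      fold = baileyWeight-fold e e≤1 j

    baileyIdentity : ∀ e → e ≤ 1 → ∀ l m n u → baileyLHS e l m n u ≈ baileyRHS e l m n u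
    baileyIdentity e e≤1 l m n u = begin
      sumℕ n (λ k → C k * (q^ (k ℕ.* u) * inv k * inv (k ℕ.+ u ℕ.+ e)))
        ≈⟨ sumℕ-cong n (λ k k≤n → trans (*-congˡ (via-bilinear k k≤n)) (pull-out k)) ⟩
      sumℕ n (λ k → poch u * sumℕ M (λ t → C k * S t k))
        ≈⟨ *-distribˡ-sumℕ n _ _ ⟨
      poch u * sumℕ n (λ k → sumℕ M (λ t → C k * S t k))
        ≈⟨ *-congˡ (sumℕ-swap n M _) ⟩
      poch u * sumℕ M (λ t → sumℕ n (λ k → C k * S t k))
        ≈⟨ *-congˡ (sumℕ-cong M (λ t _ → inner t)) ⟩
      poch u * sumℕ M (λ t → σ (J t) * A (J t) u * (q^ (foldExponent e (J t)) * pochTriple e l m n * A (J t) l * A (J t) m * A (J t) n))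
        ≈⟨ *-distribˡ-sumℕ M _ _ ⟩
      sumℕ M (λ t → poch u * (σ (J t) * A (J t) u * (q^ (foldExponent e (J t)) * pochTriple e l m n * A (J t) l * A (J t) m * A (J t) n)))
        ≈⟨ sumℕ-cong M (λ t _ → solve 8 (λ pu s au w pp al am an → pu :* (s :* au :* (w :* pp :* al :* am :* an))
                                                                    := s :* w :* pp :* pu :* al :* am :* an :* au) refl _ _ _ _ _ _ _ _) ⟩
      baileyRHS e l m n u ∎
      where
      M : ℕ
      M = n ℕ.+ n ℕ.+ e
      J : ℕ → ℤ
      J t = t ℤ.⊖ (n ℕ.+ e)
      A : ℤ → ℕ → Carrier
      A = baileyWeight e
      C : ℕ → Carrier
      C = saalschützCoefficient e l m n
      S : ℕ → ℕ → Carrier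
      S t k = σ (J t) * A (J t) k * A (J t) u
      via-bilinear : ∀ k → k ≤ n → q^ (k ℕ.* u) * inv k * inv (k ℕ.+ u ℕ.+ e) ≈ poch u * sumℕ M (λ t → S t k)
      via-bilinear k k≤n = begin
        q^ (k ℕ.* u) * inv k * inv (k ℕ.+ u ℕ.+ e)
          ≈⟨ *-identityˡ _ ⟨
        1# * (q^ (k ℕ.* u) * inv k * inv (k ℕ.+ u ℕ.+ e))
          ≈⟨ *-congʳ (poch-inv u) ⟨
        poch u * inv u * (q^ (k ℕ.* u) * inv k * inv (k ℕ.+ u ℕ.+ e))
          ≈⟨ solve 5 (λ p i x y z → p :* i :* (x :* y :* z) := p :* (x :* y :* i :* z)) refl _ _ _ _ _ ⟩
        poch u * (q^ (k ℕ.* u) * inv k * inv u * inv (k ℕ.+ u ℕ.+ e))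
          ≈⟨ *-congˡ (bilinearBaileySum e e≤1 n k u k≤n) ⟨
        poch u * sumℕ M (λ t → S t k) ∎
      pull-out : ∀ k → C k * (poch u * sumℕ M (λ t → S t k)) ≈ poch u * sumℕ M (λ t → C k * S t k)
      pull-out k = trans (solve 3 (λ c p s → c :* (p :* s) := p :* (c :* s)) refl _ _ _) (*-congˡ (*-distribˡ-sumℕ M _ _))
      inner : ∀ t → sumℕ n (λ k → C k * S t k)
                    ≈ σ (J t) * A (J t) u * (q^ (foldExponent e (J t)) * pochTriple e l m n * A (J t) l * A (J t) m * A (J t) n)
      inner t = begin
        sumℕ n (λ k → C k * S t k)
          ≈⟨ sumℕ-cong n (λ k _ → solve 4 (λ c s a b → c :* (s :* a :* b) := s :* b :* (c :* a)) refl _ _ _ _) ⟩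
        sumℕ n (λ k → σ (J t) * A (J t) u * (C k * A (J t) k))
          ≈⟨ *-distribˡ-sumℕ n _ _ ⟨
        σ (J t) * A (J t) u * sumℕ n (λ k → C k * A (J t) k)
          ≈⟨ *-congˡ (saalschütz-baileyWeight e e≤1 (J t) l m n) ⟩
        σ (J t) * A (J t) u * (q^ (foldExponent e (J t)) * pochTriple e l m n * A (J t) l * A (J t) m * A (J t) n) ∎
corollary5p5 : ∀ {c ℓ : Level} (R : CommutativeRing c ℓ)
    (q : CommutativeRing.Carrier R) (inv : ℕ → CommutativeRing.Carrier R) →
    (∀ N → CommutativeRing._≈_ R (CommutativeRing._*_ R (inv N) (QSeries.poch R q inv N)) (CommutativeRing.1# R)) →
    ∀ l m n u →
      CommutativeRing._≈_ R (QSeries.lhs1 R q inv l m n u) (QSeries.rhs1 R q inv l m n u)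
      × CommutativeRing._≈_ R (QSeries.lhs2 R q inv l m n u) (QSeries.rhs2 R q inv l m n u)
corollary5p5 R q inv inv-poch l m n u =
    trans (lhs1-as-bailey l m n u) (trans (baileyIdentity inv-poch 0 z≤n l m n u) (sym (rhs1-as-bailey l m n u)))
  , trans (lhs2-as-bailey l m n u) (trans (baileyIdentity inv-poch 1 ℕP.≤-refl l m n u) (sym (rhs2-as-bailey l m n u)))
  where
  open CommutativeRing R using (trans; sym)
  open Identities R q inv
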